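{- Let $(P,\rho)$ be a weakly ranked locally finite poset and let $\kappa$ be a $(P,\rho)$-kernel, with right KLS function $f$, left KLS function $g$, and Chow function $\mathrm{H}$. If $f_{st}(x)$ has non-negative coefficients for all $s\le t$ in $P$, or if $g_{st}(x)$ has non-negative coefficients for all $s\le t$ in $P$, then for every $s\le t$ in $P$ the polynomial $\mathrm{H}_{st}(x)$ has non-negative coefficients and is unimodal.
   Context: $P$ is a locally finite poset; $\operatorname{Int}(P)$ is its set of closed intervals. A weak rank function is a map $\rho:\operatorname{Int}(P)\to\mathbb{Z}_{\ge0}$, $[s,t]\mapsto\rho_{st}$, with $\rho_{st}>0$ whenever $s<t$ and $\rho_{st}=\rho_{sw}+\rho_{wt}$ for $s\le w\le t$. The incidence algebra $\mathcal{I}(P)$ consists of maps $a$ assigning to each $[s,t]$ a polynomial $a_{st}(x)\in\mathbb{Z}[x]$, with product $(ab)_{st}=\sum_{s\le w\le t}a_{sw}b_{wt}$ and identity $\delta$ ($\delta_{ss}=1$, $\delta_{st}=0$ for $s<t$). $\mathcal{I}_\rho(P)=\{a\in\mathcal{I}(P):\deg a_{st}\le\rho_{st}\ \forall s\le t\}$, and for $a\in\mathcal{I}_\rho(P)$ define $a^{\mathrm{rev}}_{st}(x)=x^{\rho_{st}}a_{st}(x^{ -1})$. A $(P,\rho)$-kernel is $\kappa\in\mathcal{I}_\rho(P)$ with $\kappa_{ss}=1$ for all $s$ and $\kappa^{ -1}=\kappa^{\mathrm{rev}}$. For $s<t$, $\kappa_{st}(x)$ is divisible by $x-1$; the reduced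 kernel $\overline{\kappa}$ is given by $\overline{\kappa}_{st}=\kappa_{st}/(x-1)$ for $s<t$ and $\overline{\kappa}_{ss}=-1$. The ($\kappa$-)Chow function is $\mathrm{H}=-(\overline{\kappa})^{ -1}$. The right KLS function is the unique $f\in\mathcal{I}_\rho(P)$ with $f_{ss}=1$, $\deg f_{st}<\rho_{st}/2$ for $s<t$, and $f^{\mathrm{rev}}=\kappa f$; the left KLS function is the unique $g\in\mathcal{I}_\rho(P)$ with $g_{ss}=1$, $\deg g_{st}<\rho_{st}/2$ for $s<t$, and $g^{\mathrm{rev}}=g\kappa$. A polynomial $a_0+\dots+a_mx^m$ with non-negative coefficients is unimodal if $a_0\le\dots\le a_j\ge a_{j+1}\ge\dots\ge a_m$ for some $j$. -}

module Defs where

open import Data.Nat as ℕ using (ℕ; zero; suc; _∸_; _≤ᵇ_)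
open import Data.Integer as ℤ using (ℤ; +_; -[1+_]; 0ℤ; 1ℤ)
open import Data.List using (List; []; _∷_; foldr; map; upTo)
open import Data.List.Membership.Propositional using (_∈_)
open import Data.List.Relation.Unary.Unique.Propositional using (Unique)
open import Data.Product using (_×_; Σ; ∃; ∃-syntax)
open import Data.Bool using (if_then_else_)
open import Relation.Binary.PropositionalEquality using (_≡_; _≢_)
open import Relation.Binary.Structures using (IsPartialOrder)
open import Function.Bundles using (_⇔_)
open import Level using (Level; _⊔_)

-- Polynomials in ℤ[x], represented by their coefficient sequences.
-- (Only finitely supported sequences arise; equality is coefficientwise.)

Poly : Set
Poly = ℕ → ℤ

infix 4 _≈ₚ_
_≈ₚ_ : Poly → Poly → Set
p ≈ₚ q = ∀ n → p n ≡ q n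

0ₚ : Poly
0ₚ _ = 0ℤ

1ₚ : Poly
1ₚ zero    = 1ℤ
1ₚ (suc _) = 0ℤ

-1ₚ : Poly
-1ₚ zero    = ℤ.- 1ℤ
-1ₚ (suc _) = 0ℤ

x-1ₚ : Poly
x-1ₚ zero          = ℤ.- 1ℤ
x-1ₚ (suc zero)    = 1ℤ
x-1ₚ (suc (suc _)) = 0ℤ

infixl 6 _+ₚ_
_+ₚ_ : Poly → Poly → Poly
(p +ₚ q) n = p n ℤ.+ q n

-ₚ_ : Poly → Poly
(-ₚ p) n = ℤ.- (p n)

sumℤ : List ℤ → ℤ
sumℤ = foldr ℤ._+_ 0ℤ

infixl 7 _*ₚ_
_*ₚ_ : Poly → Poly → Poly
(p *ₚ q) n = sumℤ (map (λ i → p i ℤ.* q (n ∸ i)) (upTo (suc n)))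

sumₚ : List Poly → Poly
sumₚ = foldr _+ₚ_ 0ₚ

DegLe : Poly → ℕ → Set
DegLe p d = ∀ n → d ℕ.< n → p n ≡ 0ℤ

DegLtHalf : Poly → ℕ → Set
DegLtHalf p r = ∀ n → r ℕ.≤ 2 ℕ.* n → p n ≡ 0ℤ

-- x^d p(x^{-1})  (meaningful when deg p ≤ d)
rev : ℕ → Poly → Poly
rev d p n = if n ≤ᵇ d then p (d ∸ n) else 0ℤ

NonNeg : Poly → Set
NonNeg p = ∀ n → 0ℤ ℤ.≤ p n

Unimodal : Poly → Set
Unimodal p = ∃[ j ] ((∀ i → i ℕ.< j → p i ℤ.≤ p (suc i))
                   × (∀ i → j ℕ.≤ i → p (suc i) ℤ.≤ p i))

record LocallyFinitePoset (c ℓ : Level) : Set (Level.suc (c ⊔ ℓ)) where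
  field
    Carrier        : Set c
    _≤_            : Carrier → Carrier → Set ℓ
    isPartialOrder : IsPartialOrder _≡_ _≤_
    interval       : Carrier → Carrier → List Carrier
    interval-unique : ∀ s t → Unique (interval s t)
    interval-mem   : ∀ s t w → (w ∈ interval s t) ⇔ ((s ≤ w) × (w ≤ t))

  _<_ : Carrier → Carrier → Set (c ⊔ ℓ)
  s < t = (s ≤ t) × (s ≢ t)

module _ {c ℓ : Level} (P : LocallyFinitePoset c ℓ) where
  open LocallyFinitePoset P

  -- elements of the incidence algebra: only values on intervals s ≤ t matter
  Inc : Set c
  Inc = Carrier → Carrier → Poly

  _⊛_ : Inc → Inc → Inc
  (a ⊛ b) s t = sumₚ (map (λ w → a s w *ₚ b w t) (interval s t))

  IsDelta : Inc → Set (c ⊔ ℓ)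
  IsDelta a = (∀ s → a s s ≈ₚ 1ₚ) × (∀ s t → s < t → a s t ≈ₚ 0ₚ)

  IsMinusDelta : Inc → Set (c ⊔ ℓ)
  IsMinusDelta a = (∀ s → a s s ≈ₚ -1ₚ) × (∀ s t → s < t → a s t ≈ₚ 0ₚ)

  IsInverse : Inc → Inc → Set (c ⊔ ℓ)
  IsInverse a b = IsDelta (a ⊛ b) × IsDelta (b ⊛ a)

  record WeakRank : Set (c ⊔ ℓ) where
    field
      ρ     : Carrier → Carrier → ℕ
      pos   : ∀ s t → s < t → 0 ℕ.< ρ s t
      additive : ∀ s w t → s ≤ w → w ≤ t → ρ s t ≡ ρ s w ℕ.+ ρ w t

  module _ (R : WeakRank) where
    open WeakRank R

    InIρ : Inc → Set (c ⊔ ℓ)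
    InIρ a = ∀ s t → s ≤ t → DegLe (a s t) (ρ s t)

    revInc : Inc → Inc
    revInc a s t = rev (ρ s t) (a s t)

    IsKernel : Inc → Set (c ⊔ ℓ)
    IsKernel κ = InIρ κ × (∀ s → κ s s ≈ₚ 1ₚ) × IsInverse κ (revInc κ)

    IsReducedKernel : Inc → Inc → Set (c ⊔ ℓ)
    IsReducedKernel κ κ̄ = (∀ s → κ̄ s s ≈ₚ -1ₚ)
                        × (∀ s t → s < t → x-1ₚ *ₚ κ̄ s t ≈ₚ κ s t)

    IsChow : Inc → Inc → Set (c ⊔ ℓ)
    IsChow κ H = ∃[ κ̄ ] (IsReducedKernel κ κ̄
                         × IsInverse κ̄ (λ s t → -ₚ (H s t)))

    IsRightKLS : Inc → Inc → Set (c ⊔ ℓ)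
    IsRightKLS κ f = InIρ f × (∀ s → f s s ≈ₚ 1ₚ)
                   × (∀ s t → s < t → DegLtHalf (f s t) (ρ s t))
                   × (∀ s t → s ≤ t → revInc f s t ≈ₚ (κ ⊛ f) s t)

    IsLeftKLS : Inc → Inc → Set (c ⊔ ℓ)
    IsLeftKLS κ g = InIρ g × (∀ s → g s s ≈ₚ 1ₚ)
                  × (∀ s t → s < t → DegLtHalf (g s t) (ρ s t))
                  × (∀ s t → s ≤ t → revInc g s t ≈ₚ (g ⊛ κ) s t)

{-# OPTIONS --safe #-}
-- Writing κ = x δ + (x − 1) κ̄, the identities f^rev = κ f and H κ̄ = −δ give
-- H (f^rev − x f) = −(x − 1) f.  Isolating the terms w = s and w = t of this product and
-- cancelling x − 1 yields, for s < t,
--   H_st = Q_{ρ_st}(f_st) + Σ_{s<w<t} H_sw · x Q_{ρ_wt − 1}(f_wt),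
-- where Q_r(f) = (x^r f(x⁻¹) − f) / (x − 1) = Σᵢ fᵢ xⁱ [r − 2i]ₓ.  When f is non-negative, each
-- Q_r(f) is a non-negative combination of the symmetric unimodal polynomials xⁱ [r − 2i]ₓ, all
-- centred at (r − 1)/2.  Such combinations with a common centre are closed under sums, and under
-- products (the centres add), so induction on ρ_st shows that H_st is symmetric and unimodal about
-- (ρ_st − 1)/2.  The left KLS case is the right KLS case on the opposite poset.
module Submission where

open import Defs
open import Level using (Level)
open import Data.Product using (_×_)
open import Data.Sum using (_⊎_)

open import Level using (_⊔_)
open import Function using (_∘_; flip)
open import Function.Bundles using (_⇔_; mk⇔; Equivalence)
open import Data.Empty using (⊥; ⊥-elim)
open import Data.Maybe using (just; nothing)
open import Data.Product using (_,_; proj₁; proj₂; uncurry; swap; Σ-syntax)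
open import Data.Sum using (inj₁; inj₂)
open import Relation.Nullary using (¬_; yes; no)
open import Relation.Nullary.Decidable using (decidable-stable)
open import Relation.Binary.PropositionalEquality
  using (_≡_; _≢_; refl; sym; trans; cong; cong₂; subst; module ≡-Reasoning)
open import Relation.Binary.Definitions using (WeaklyDecidable)
open import Relation.Binary.Structures using (IsPartialOrder)
import Relation.Binary.Construct.Flip.EqAndOrd as Flip
import Relation.Binary.Reasoning.Setoid as SetoidReasoning

open import Data.Nat as ℕ using (ℕ; zero; suc; _∸_; z≤n; s≤s)
import Data.Nat.Properties as ℕP
open import Data.Integer as ℤ using (ℤ; 0ℤ; 1ℤ)
import Data.Integer.Properties as ℤP
open import Data.Integer.Tactic.RingSolver using (solve-∀)

open import Data.List using (List; []; _∷_; _++_; map; applyUpTo)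
open import Data.List.Properties using (map-∘)
open import Data.List.Membership.Propositional using (_∈_)
open import Data.List.Membership.Propositional.Properties
  using (∈-∃++; ∈-++⁺ˡ; ∈-++⁺ʳ; ∈-++⁻; ∈-map⁺; ∈-map⁻)
open import Data.List.Membership.Propositional.Properties.WithK using (unique∧set⇒bag)
open import Data.List.Relation.Unary.Any using (here; there)
open import Data.List.Relation.Unary.All as All using (_∷_)
open import Data.List.Relation.Unary.AllPairs using ([]; _∷_)
open import Data.List.Relation.Unary.Unique.Propositional using (Unique)
import Data.List.Relation.Unary.Unique.Propositional.Properties as UniqueP
open import Data.List.Relation.Binary.Permutation.Propositional as ↭ using (_↭_; ↭-sym)
open import Data.List.Relation.Binary.Permutation.Propositional.Properties
  using (All-resp-↭; ∈-resp-↭) renaming (shift to ↭-shift)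
open import Data.List.Relation.Binary.BagAndSetEquality using (∼bag⇒↭)

open import Algebra.Bundles using (CommutativeRing)
open import Algebra.Solver.Ring.AlmostCommutativeRing
  using (fromCommutativeRing; _-Raw-AlmostCommutative⟶_; Induced-equivalence)
import Algebra.Solver.Ring

-- The polynomial ring ℤ[x]

shift : Poly → Poly
shift p n = p (suc n)

infixr 8 x·_
x·_ : Poly → Poly
(x· p) zero    = 0ℤ
(x· p) (suc n) = p n

infixr 7 _·ₚ_
_·ₚ_ : ℤ → Poly → Poly
(c ·ₚ p) n = c ℤ.* p n

const : ℤ → Poly
const c = c ·ₚ 1ₚ

≈const+x·shift : ∀ p → p ≈ₚ const (p 0) +ₚ x· shift p
≈const+x·shift p zero    = sym (trans (ℤP.+-identityʳ _) (ℤP.*-identityʳ (p 0)))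
≈const+x·shift p (suc n) = sym (trans (cong (ℤ._+ p (suc n)) (ℤP.*-zeroʳ (p 0))) (ℤP.+-identityˡ _))

*ₚ-zero : ∀ p q → (p *ₚ q) 0 ≡ p 0 ℤ.* q 0
*ₚ-zero p q = ℤP.+-identityʳ _

*ₚ-suc : ∀ p q n → (p *ₚ q) (suc n) ≡ p 0 ℤ.* q (suc n) ℤ.+ (shift p *ₚ q) n
*ₚ-suc p q n = cong (λ l → p 0 ℤ.* q (suc n) ℤ.+ sumℤ l)
  (trans (map-applyUpTo (λ i → p i ℤ.* q (suc n ∸ i)) suc (suc n))
         (sym (map-applyUpTo (λ i → p (suc i) ℤ.* q (n ∸ i)) (λ i → i) (suc n))))
  where
  map-applyUpTo : ∀ (g : ℕ → ℤ) h m → map g (applyUpTo h m) ≡ applyUpTo (g ∘ h) m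
  map-applyUpTo g h zero    = refl
  map-applyUpTo g h (suc m) = cong (g (h 0) ∷_) (map-applyUpTo g (h ∘ suc) m)

module _ where
  open ≡-Reasoning

  *ₚ-congˡ : ∀ p {q q′} → q ≈ₚ q′ → p *ₚ q ≈ₚ p *ₚ q′
  *ₚ-congˡ p {q} {q′} q≈q′ zero = begin
    (p *ₚ q) 0       ≡⟨ *ₚ-zero p q ⟩
    p 0 ℤ.* q 0      ≡⟨ cong (p 0 ℤ.*_) (q≈q′ 0) ⟩
    p 0 ℤ.* q′ 0     ≡⟨ *ₚ-zero p q′ ⟨
    (p *ₚ q′) 0      ∎
  *ₚ-congˡ p {q} {q′} q≈q′ (suc n) = begin
    (p *ₚ q) (suc n)
      ≡⟨ *ₚ-suc p q n ⟩
    p 0 ℤ.* q (suc n) ℤ.+ (shift p *ₚ q) n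
      ≡⟨ cong₂ (λ a b → p 0 ℤ.* a ℤ.+ b) (q≈q′ (suc n)) (*ₚ-congˡ (shift p) q≈q′ n) ⟩
    p 0 ℤ.* q′ (suc n) ℤ.+ (shift p *ₚ q′) n
      ≡⟨ *ₚ-suc p q′ n ⟨
    (p *ₚ q′) (suc n) ∎

  *ₚ-distribˡ : ∀ p q r → p *ₚ (q +ₚ r) ≈ₚ p *ₚ q +ₚ p *ₚ r
  *ₚ-distribˡ p q r zero = begin
    (p *ₚ (q +ₚ r)) 0                ≡⟨ *ₚ-zero p (q +ₚ r) ⟩
    p 0 ℤ.* (q 0 ℤ.+ r 0)            ≡⟨ ℤP.*-distribˡ-+ (p 0) (q 0) (r 0) ⟩
    p 0 ℤ.* q 0 ℤ.+ p 0 ℤ.* r 0      ≡⟨ cong₂ ℤ._+_ (*ₚ-zero p q) (*ₚ-zero p r) ⟨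
    (p *ₚ q +ₚ p *ₚ r) 0             ∎
  *ₚ-distribˡ p q r (suc n) = begin
    (p *ₚ (q +ₚ r)) (suc n)
      ≡⟨ *ₚ-suc p (q +ₚ r) n ⟩
    p 0 ℤ.* (q (suc n) ℤ.+ r (suc n)) ℤ.+ (shift p *ₚ (q +ₚ r)) n
      ≡⟨ cong (ℤ._+_ (p 0 ℤ.* (q (suc n) ℤ.+ r (suc n)))) (*ₚ-distribˡ (shift p) q r n) ⟩
    p 0 ℤ.* (q (suc n) ℤ.+ r (suc n)) ℤ.+ ((shift p *ₚ q) n ℤ.+ (shift p *ₚ r) n)
      ≡⟨ regroup (p 0) (q (suc n)) (r (suc n)) _ _ ⟩
    (p 0 ℤ.* q (suc n) ℤ.+ (shift p *ₚ q) n) ℤ.+ (p 0 ℤ.* r (suc n) ℤ.+ (shift p *ₚ r) n)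
      ≡⟨ cong₂ ℤ._+_ (*ₚ-suc p q n) (*ₚ-suc p r n) ⟨
    (p *ₚ q +ₚ p *ₚ r) (suc n) ∎
    where
    regroup : ∀ a b c d e → a ℤ.* (b ℤ.+ c) ℤ.+ (d ℤ.+ e) ≡ (a ℤ.* b ℤ.+ d) ℤ.+ (a ℤ.* c ℤ.+ e)
    regroup = solve-∀

  *ₚ-scalarʳ : ∀ c p q → p *ₚ (c ·ₚ q) ≈ₚ c ·ₚ (p *ₚ q)
  *ₚ-scalarʳ c p q zero = begin
    (p *ₚ (c ·ₚ q)) 0       ≡⟨ *ₚ-zero p (c ·ₚ q) ⟩
    p 0 ℤ.* (c ℤ.* q 0)     ≡⟨ ℤP.*-comm (p 0) _ ⟩
    c ℤ.* q 0 ℤ.* p 0       ≡⟨ ℤP.*-assoc c (q 0) (p 0) ⟩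
    c ℤ.* (q 0 ℤ.* p 0)     ≡⟨ cong (c ℤ.*_) (trans (ℤP.*-comm (q 0) (p 0)) (sym (*ₚ-zero p q))) ⟩
    c ℤ.* (p *ₚ q) 0        ∎
  *ₚ-scalarʳ c p q (suc n) = begin
    (p *ₚ (c ·ₚ q)) (suc n)
      ≡⟨ *ₚ-suc p (c ·ₚ q) n ⟩
    p 0 ℤ.* (c ℤ.* q (suc n)) ℤ.+ (shift p *ₚ (c ·ₚ q)) n
      ≡⟨ cong (ℤ._+_ (p 0 ℤ.* (c ℤ.* q (suc n)))) (*ₚ-scalarʳ c (shift p) q n) ⟩
    p 0 ℤ.* (c ℤ.* q (suc n)) ℤ.+ c ℤ.* (shift p *ₚ q) n
      ≡⟨ regroup c (p 0) (q (suc n)) _ ⟩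
    c ℤ.* (p 0 ℤ.* q (suc n) ℤ.+ (shift p *ₚ q) n)
      ≡⟨ cong (c ℤ.*_) (*ₚ-suc p q n) ⟨
    c ℤ.* (p *ₚ q) (suc n) ∎
    where
    regroup : ∀ a b d e → b ℤ.* (a ℤ.* d) ℤ.+ a ℤ.* e ≡ a ℤ.* (b ℤ.* d ℤ.+ e)
    regroup = solve-∀

  *ₚ-identityʳ : ∀ p → p *ₚ 1ₚ ≈ₚ p
  *ₚ-identityʳ p zero    = trans (*ₚ-zero p 1ₚ) (ℤP.*-identityʳ (p 0))
  *ₚ-identityʳ p (suc n) = begin
    (p *ₚ 1ₚ) (suc n)                  ≡⟨ *ₚ-suc p 1ₚ n ⟩
    p 0 ℤ.* 0ℤ ℤ.+ (shift p *ₚ 1ₚ) n   ≡⟨ cong₂ ℤ._+_ (ℤP.*-zeroʳ (p 0)) (*ₚ-identityʳ (shift p) n) ⟩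
    0ℤ ℤ.+ p (suc n)                   ≡⟨ ℤP.+-identityˡ _ ⟩
    p (suc n)                          ∎

  *ₚ-x·ʳ : ∀ p q → p *ₚ x· q ≈ₚ x· (p *ₚ q)
  *ₚ-x·ʳ p q zero = trans (*ₚ-zero p (x· q)) (ℤP.*-zeroʳ (p 0))
  *ₚ-x·ʳ p q (suc n) = begin
    (p *ₚ x· q) (suc n)                            ≡⟨ *ₚ-suc p (x· q) n ⟩
    p 0 ℤ.* q n ℤ.+ (shift p *ₚ x· q) n            ≡⟨ cong (ℤ._+_ (p 0 ℤ.* q n)) (*ₚ-x·ʳ (shift p) q n) ⟩
    p 0 ℤ.* q n ℤ.+ (x· (shift p *ₚ q)) n          ≡⟨ lower n ⟩
    (p *ₚ q) n                                     ∎
    where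
    lower : ∀ n → p 0 ℤ.* q n ℤ.+ (x· (shift p *ₚ q)) n ≡ (p *ₚ q) n
    lower zero    = trans (ℤP.+-identityʳ _) (sym (*ₚ-zero p q))
    lower (suc m) = sym (*ₚ-suc p q m)

  *ₚ-expandʳ : ∀ p q → p *ₚ q ≈ₚ q 0 ·ₚ p +ₚ x· (p *ₚ shift q)
  *ₚ-expandʳ p q n = begin
    (p *ₚ q) n                                       ≡⟨ *ₚ-congˡ p (≈const+x·shift q) n ⟩
    (p *ₚ (const (q 0) +ₚ x· shift q)) n             ≡⟨ *ₚ-distribˡ p (const (q 0)) (x· shift q) n ⟩
    (p *ₚ const (q 0)) n ℤ.+ (p *ₚ x· shift q) n     ≡⟨ cong₂ ℤ._+_ (*ₚ-scalarʳ (q 0) p 1ₚ n) (*ₚ-x·ʳ p (shift q) n) ⟩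
    q 0 ℤ.* (p *ₚ 1ₚ) n ℤ.+ (x· (p *ₚ shift q)) n    ≡⟨ cong (λ a → q 0 ℤ.* a ℤ.+ (x· (p *ₚ shift q)) n) (*ₚ-identityʳ p n) ⟩
    q 0 ℤ.* p n ℤ.+ (x· (p *ₚ shift q)) n            ∎

  -- Expanding both factors at 0, p q = p₀ q₀ + x (p₀ shift q + q₀ shift p) + x² (shift p · shift q).
  *ₚ-comm : ∀ p q → p *ₚ q ≈ₚ q *ₚ p
  *ₚ-comm p q zero    = trans (*ₚ-zero p q) (trans (ℤP.*-comm (p 0) (q 0)) (sym (*ₚ-zero q p)))
  *ₚ-comm p q (suc n) = begin
    (p *ₚ q) (suc n)
      ≡⟨ expand p q ⟩
    p 0 ℤ.* q (suc n) ℤ.+ (q 0 ℤ.* p (suc n) ℤ.+ (x· (shift p *ₚ shift q)) n)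
      ≡⟨ cong (λ a → p 0 ℤ.* q (suc n) ℤ.+ (q 0 ℤ.* p (suc n) ℤ.+ a)) (tail-comm n) ⟩
    p 0 ℤ.* q (suc n) ℤ.+ (q 0 ℤ.* p (suc n) ℤ.+ (x· (shift q *ₚ shift p)) n)
      ≡⟨ left-comm (p 0 ℤ.* q (suc n)) (q 0 ℤ.* p (suc n)) _ ⟩
    q 0 ℤ.* p (suc n) ℤ.+ (p 0 ℤ.* q (suc n) ℤ.+ (x· (shift q *ₚ shift p)) n)
      ≡⟨ expand q p ⟨
    (q *ₚ p) (suc n) ∎
    where
    expand : ∀ p q → (p *ₚ q) (suc n) ≡ p 0 ℤ.* q (suc n) ℤ.+ (q 0 ℤ.* p (suc n) ℤ.+ (x· (shift p *ₚ shift q)) n)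
    expand p q = trans (*ₚ-suc p q n) (cong (ℤ._+_ (p 0 ℤ.* q (suc n))) (*ₚ-expandʳ (shift p) q n))
    tail-comm : ∀ n → (x· (shift p *ₚ shift q)) n ≡ (x· (shift q *ₚ shift p)) n
    tail-comm zero    = refl
    tail-comm (suc m) = *ₚ-comm (shift p) (shift q) m
    left-comm : ∀ a b c → a ℤ.+ (b ℤ.+ c) ≡ b ℤ.+ (a ℤ.+ c)
    left-comm = solve-∀

  *ₚ-congʳ : ∀ {p p′} q → p ≈ₚ p′ → p *ₚ q ≈ₚ p′ *ₚ q
  *ₚ-congʳ {p} {p′} q p≈p′ n = trans (*ₚ-comm p q n) (trans (*ₚ-congˡ q p≈p′ n) (*ₚ-comm q p′ n))

  *ₚ-distribʳ : ∀ p q r → (q +ₚ r) *ₚ p ≈ₚ q *ₚ p +ₚ r *ₚ p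
  *ₚ-distribʳ p q r n = begin
    ((q +ₚ r) *ₚ p) n              ≡⟨ *ₚ-comm (q +ₚ r) p n ⟩
    (p *ₚ (q +ₚ r)) n              ≡⟨ *ₚ-distribˡ p q r n ⟩
    (p *ₚ q) n ℤ.+ (p *ₚ r) n      ≡⟨ cong₂ ℤ._+_ (*ₚ-comm p q n) (*ₚ-comm p r n) ⟩
    (q *ₚ p) n ℤ.+ (r *ₚ p) n      ∎

  *ₚ-scalarˡ : ∀ c p q → (c ·ₚ p) *ₚ q ≈ₚ c ·ₚ (p *ₚ q)
  *ₚ-scalarˡ c p q n =
    trans (*ₚ-comm (c ·ₚ p) q n) (trans (*ₚ-scalarʳ c q p n) (cong (c ℤ.*_) (*ₚ-comm q p n)))

  *ₚ-identityˡ : ∀ p → 1ₚ *ₚ p ≈ₚ p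
  *ₚ-identityˡ p n = trans (*ₚ-comm 1ₚ p n) (*ₚ-identityʳ p n)

  *ₚ-assoc : ∀ p q r → (p *ₚ q) *ₚ r ≈ₚ p *ₚ (q *ₚ r)
  *ₚ-assoc p q r zero = begin
    ((p *ₚ q) *ₚ r) 0          ≡⟨ trans (*ₚ-zero (p *ₚ q) r) (cong (ℤ._* r 0) (*ₚ-zero p q)) ⟩
    p 0 ℤ.* q 0 ℤ.* r 0        ≡⟨ ℤP.*-assoc (p 0) (q 0) (r 0) ⟩
    p 0 ℤ.* (q 0 ℤ.* r 0)      ≡⟨ sym (trans (*ₚ-zero p (q *ₚ r)) (cong (p 0 ℤ.*_) (*ₚ-zero q r))) ⟩
    (p *ₚ (q *ₚ r)) 0          ∎
  *ₚ-assoc p q r (suc n) = begin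
    ((p *ₚ q) *ₚ r) (suc n)
      ≡⟨ *ₚ-suc (p *ₚ q) r n ⟩
    (p *ₚ q) 0 ℤ.* r (suc n) ℤ.+ (shift (p *ₚ q) *ₚ r) n
      ≡⟨ cong₂ ℤ._+_ (cong (ℤ._* r (suc n)) (*ₚ-zero p q)) (*ₚ-congʳ r (*ₚ-suc p q) n) ⟩
    p 0 ℤ.* q 0 ℤ.* r (suc n) ℤ.+ ((p 0 ·ₚ shift q +ₚ shift p *ₚ q) *ₚ r) n
      ≡⟨ cong (ℤ._+_ (p 0 ℤ.* q 0 ℤ.* r (suc n))) (*ₚ-distribʳ r (p 0 ·ₚ shift q) (shift p *ₚ q) n) ⟩
    p 0 ℤ.* q 0 ℤ.* r (suc n) ℤ.+ (((p 0 ·ₚ shift q) *ₚ r) n ℤ.+ ((shift p *ₚ q) *ₚ r) n)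
      ≡⟨ cong (ℤ._+_ (p 0 ℤ.* q 0 ℤ.* r (suc n)))
              (cong₂ ℤ._+_ (*ₚ-scalarˡ (p 0) (shift q) r n) (*ₚ-assoc (shift p) q r n)) ⟩
    p 0 ℤ.* q 0 ℤ.* r (suc n) ℤ.+ (p 0 ℤ.* (shift q *ₚ r) n ℤ.+ (shift p *ₚ (q *ₚ r)) n)
      ≡⟨ regroup (p 0) (q 0) (r (suc n)) _ _ ⟩
    p 0 ℤ.* (q 0 ℤ.* r (suc n) ℤ.+ (shift q *ₚ r) n) ℤ.+ (shift p *ₚ (q *ₚ r)) n
      ≡⟨ cong (λ a → p 0 ℤ.* a ℤ.+ (shift p *ₚ (q *ₚ r)) n) (*ₚ-suc q r n) ⟨
    p 0 ℤ.* (q *ₚ r) (suc n) ℤ.+ (shift p *ₚ (q *ₚ r)) n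
      ≡⟨ *ₚ-suc p (q *ₚ r) n ⟨
    (p *ₚ (q *ₚ r)) (suc n) ∎
    where
    regroup : ∀ a b c d e → a ℤ.* b ℤ.* c ℤ.+ (a ℤ.* d ℤ.+ e) ≡ a ℤ.* (b ℤ.* c ℤ.+ d) ℤ.+ e
    regroup = solve-∀

polyRing : CommutativeRing _ _
polyRing = record
  { Carrier = Poly ; _≈_ = _≈ₚ_ ; _+_ = _+ₚ_ ; _*_ = _*ₚ_ ; -_ = -ₚ_ ; 0# = 0ₚ ; 1# = 1ₚ
  ; isCommutativeRing = record
    { isRing = record
      { +-isAbelianGroup = record
        { isGroup = record
          { isMonoid = record
            { isSemigroup = record
              { isMagma = record
                { isEquivalence = record
                    { refl = λ _ → refl ; sym = λ e n → sym (e n) ; trans = λ e e′ n → trans (e n) (e′ n) }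
                ; ∙-cong = λ e e′ n → cong₂ ℤ._+_ (e n) (e′ n) }
              ; assoc = λ p q r n → ℤP.+-assoc (p n) (q n) (r n) }
            ; identity = (λ p n → ℤP.+-identityˡ (p n)) , (λ p n → ℤP.+-identityʳ (p n)) }
          ; inverse = (λ p n → ℤP.+-inverseˡ (p n)) , (λ p n → ℤP.+-inverseʳ (p n))
          ; ⁻¹-cong = λ e n → cong ℤ.-_ (e n) }
        ; comm = λ p q n → ℤP.+-comm (p n) (q n) }
      ; *-cong = λ {p} {p′} {q} {q′} p≈p′ q≈q′ n → trans (*ₚ-congʳ q p≈p′ n) (*ₚ-congˡ p′ q≈q′ n)
      ; *-assoc = *ₚ-assoc
      ; *-identity = *ₚ-identityˡ , *ₚ-identityʳ
      ; distrib = *ₚ-distribˡ , *ₚ-distribʳ }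
    ; *-comm = *ₚ-comm } }

module ℙ = CommutativeRing polyRing
open import Algebra.Properties.Ring ℙ.ring using (-‿distribˡ-*; -‿distribʳ-*; -1*x≈-x; -‿+-comm; -‿involutive)
open import Algebra.Properties.CommutativeSemigroup ℙ.*-commutativeSemigroup
  using () renaming (x∙yz≈y∙xz to x*yz≈y*xz)
open import Algebra.Properties.CommutativeSemigroup ℙ.+-commutativeSemigroup
  using () renaming (x∙yz≈y∙xz to x+yz≈y+xz)

const-homomorphism : ℤ.+-*-rawRing -Raw-AlmostCommutative⟶ fromCommutativeRing polyRing
const-homomorphism = record
  { ⟦_⟧    = const
  ; +-homo = λ a b n → ℤP.*-distribʳ-+ (1ₚ n) a b
  ; *-homo = λ a b n → trans (ℤP.*-assoc a b (1ₚ n))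
      (sym (trans (*ₚ-scalarˡ a 1ₚ (const b) n) (cong (a ℤ.*_) (*ₚ-identityˡ (const b) n))))
  ; -‿homo = λ a n → sym (ℤP.neg-distribˡ-* a (1ₚ n))
  ; 0-homo = λ n → ℤP.*-zeroˡ (1ₚ n)
  ; 1-homo = λ n → ℤP.*-identityˡ (1ₚ n) }

const-≟ : WeaklyDecidable (Induced-equivalence const-homomorphism)
const-≟ a b with a ℤ.≟ b
... | yes refl = just ℙ.refl
... | no _     = nothing

module PolySolver = Algebra.Solver.Ring ℤ.+-*-rawRing (fromCommutativeRing polyRing) const-homomorphism const-≟
open PolySolver using (solve; _:+_; _:*_; _:-_; :-_; _:=_)

x·-cong : ∀ {p q} → p ≈ₚ q → x· p ≈ₚ x· q
x·-cong p≈q zero    = refl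
x·-cong p≈q (suc n) = p≈q n

xₚ : Poly
xₚ = x· 1ₚ

xₚ*ₚ≈x· : ∀ p → xₚ *ₚ p ≈ₚ x· p
xₚ*ₚ≈x· p = ℙ.trans (*ₚ-comm xₚ p) (ℙ.trans (*ₚ-x·ʳ p 1ₚ) (x·-cong (*ₚ-identityʳ p)))

x-1ₚ≈xₚ-1ₚ : x-1ₚ ≈ₚ xₚ +ₚ -ₚ 1ₚ
x-1ₚ≈xₚ-1ₚ zero          = refl
x-1ₚ≈xₚ-1ₚ (suc zero)    = refl
x-1ₚ≈xₚ-1ₚ (suc (suc n)) = refl

x-1ₚ*ₚ≈x·-id : ∀ p → x-1ₚ *ₚ p ≈ₚ x· p +ₚ -ₚ p
x-1ₚ*ₚ≈x·-id p = begin
  x-1ₚ *ₚ p                       ≈⟨ *ₚ-congʳ p x-1ₚ≈xₚ-1ₚ ⟩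
  (xₚ +ₚ -ₚ 1ₚ) *ₚ p              ≈⟨ ℙ.distribʳ p xₚ (-ₚ 1ₚ) ⟩
  xₚ *ₚ p +ₚ (-ₚ 1ₚ) *ₚ p         ≈⟨ ℙ.+-cong (xₚ*ₚ≈x· p) (-1*x≈-x p) ⟩
  x· p +ₚ -ₚ p                    ∎
  where open SetoidReasoning ℙ.setoid

-1ₚ≈-ₚ1ₚ : -1ₚ ≈ₚ -ₚ 1ₚ
-1ₚ≈-ₚ1ₚ zero    = refl
-1ₚ≈-ₚ1ₚ (suc n) = refl

xₚ*ₚ≈id+x-1ₚ*ₚ : ∀ p → xₚ *ₚ p ≈ₚ p +ₚ x-1ₚ *ₚ p
xₚ*ₚ≈id+x-1ₚ*ₚ p = begin
  xₚ *ₚ p                    ≈⟨ xₚ*ₚ≈x· p ⟩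
  x· p                       ≈⟨ regroup (x· p) p ⟩
  p +ₚ (x· p +ₚ -ₚ p)        ≈⟨ ℙ.+-congˡ {p} (x-1ₚ*ₚ≈x·-id p) ⟨
  p +ₚ x-1ₚ *ₚ p             ∎
  where
  open SetoidReasoning ℙ.setoid
  regroup : ∀ a p → a ≈ₚ p +ₚ (a +ₚ -ₚ p)
  regroup = solve 2 (λ a p → a := p :+ (a :- p)) ℙ.refl

x-1ₚ*ₚ-cancelˡ : ∀ p q → x-1ₚ *ₚ p ≈ₚ x-1ₚ *ₚ q → p ≈ₚ q
x-1ₚ*ₚ-cancelˡ p q e n = ℤP.i-j≡0⇒i≡j (p n) (q n) (x-invariant⇒0 (p +ₚ -ₚ q) x·r≈r n)
  where
  x·r≈r : x· (p +ₚ -ₚ q) +ₚ -ₚ (p +ₚ -ₚ q) ≈ₚ 0ₚ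
  x·r≈r = begin
    x· (p +ₚ -ₚ q) +ₚ -ₚ (p +ₚ -ₚ q)  ≈⟨ x-1ₚ*ₚ≈x·-id (p +ₚ -ₚ q) ⟨
    x-1ₚ *ₚ (p +ₚ -ₚ q)               ≈⟨ ℙ.distribˡ x-1ₚ p (-ₚ q) ⟩
    x-1ₚ *ₚ p +ₚ x-1ₚ *ₚ -ₚ q         ≈⟨ ℙ.+-cong e (ℙ.sym (-‿distribʳ-* x-1ₚ q)) ⟩
    x-1ₚ *ₚ q +ₚ -ₚ (x-1ₚ *ₚ q)       ≈⟨ ℙ.-‿inverseʳ (x-1ₚ *ₚ q) ⟩
    0ₚ                                ∎
    where open SetoidReasoning ℙ.setoid
  -- r = x r forces r₀ = 0 and then r (n + 1) = r n.
  x-invariant⇒0 : ∀ r → x· r +ₚ -ₚ r ≈ₚ 0ₚ → r ≈ₚ 0ₚ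
  x-invariant⇒0 r e zero    = trans (sym (ℤP.neg-involutive (r 0))) (cong ℤ.-_ (trans (sym (ℤP.+-identityˡ _)) (e 0)))
  x-invariant⇒0 r e (suc n) = trans (sym (ℤP.i-j≡0⇒i≡j (r n) (r (suc n)) (e (suc n)))) (x-invariant⇒0 r e n)

const*ₚ≈·ₚ : ∀ c p → const c *ₚ p ≈ₚ c ·ₚ p
const*ₚ≈·ₚ c p n = trans (*ₚ-scalarˡ c 1ₚ p n) (cong (c ℤ.*_) (*ₚ-identityˡ p n))

-- [ k ]ₓ = 1 + x + ⋯ + x^(k-1)
[_]ₓ : ℕ → Poly
[ zero  ]ₓ _       = 0ℤ
[ suc k ]ₓ zero    = 1ℤ
[ suc k ]ₓ (suc n) = [ k ]ₓ n

[]ₓ-suc : ∀ k → [ suc k ]ₓ ≈ₚ 1ₚ +ₚ xₚ *ₚ [ k ]ₓ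
[]ₓ-suc k = ℙ.trans pointwise (ℙ.+-congˡ {1ₚ} (ℙ.sym (xₚ*ₚ≈x· [ k ]ₓ)))
  where
  pointwise : [ suc k ]ₓ ≈ₚ 1ₚ +ₚ x· [ k ]ₓ
  pointwise zero    = refl
  pointwise (suc n) = sym (ℤP.+-identityˡ _)

[1]ₓ≈1ₚ : [ 1 ]ₓ ≈ₚ 1ₚ
[1]ₓ≈1ₚ zero    = refl
[1]ₓ≈1ₚ (suc n) = refl

[1]ₓ-identityˡ : ∀ q → [ 1 ]ₓ *ₚ q ≈ₚ q
[1]ₓ-identityˡ q = ℙ.trans (*ₚ-congʳ q [1]ₓ≈1ₚ) (*ₚ-identityˡ q)

infix 8 x^_
x^_ : ℕ → Poly
x^ zero  = 1ₚ
x^ suc k = x· x^ k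

x-1ₚ*[]ₓ : ∀ k → x-1ₚ *ₚ [ k ]ₓ ≈ₚ x^ k +ₚ -ₚ 1ₚ
x-1ₚ*[]ₓ k = ℙ.trans (x-1ₚ*ₚ≈x·-id [ k ]ₓ) (telescope k)
  where
  telescope : ∀ k → x· [ k ]ₓ +ₚ -ₚ [ k ]ₓ ≈ₚ x^ k +ₚ -ₚ 1ₚ
  telescope zero          zero          = refl
  telescope zero          (suc n)       = refl
  telescope (suc k)       zero          = refl
  telescope (suc zero)    (suc zero)    = refl
  telescope (suc (suc k)) (suc zero)    = refl
  telescope (suc k)       (suc (suc n)) = telescope k (suc n)

rev-suc : ∀ r f → f (suc r) ≡ 0ℤ → rev (suc r) f ≈ₚ x· rev r f
rev-suc r f f₁₊ᵣ≡0 zero          = f₁₊ᵣ≡0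
rev-suc r f f₁₊ᵣ≡0 (suc zero)    = refl
rev-suc r f f₁₊ᵣ≡0 (suc (suc n)) = refl

rev-shift : ∀ r f → rev (suc r) f ≈ₚ f 0 ·ₚ x^ suc r +ₚ rev r (shift f)
rev-shift r       f zero          = sym (trans (cong (ℤ._+ f (suc r)) (ℤP.*-zeroʳ (f 0))) (ℤP.+-identityˡ _))
rev-shift zero    f (suc zero)    = sym (trans (ℤP.+-identityʳ _) (ℤP.*-identityʳ (f 0)))
rev-shift zero    f (suc (suc n)) = sym (trans (ℤP.+-identityʳ _) (ℤP.*-zeroʳ (f 0)))
rev-shift (suc r) f (suc zero)    = rev-shift r f zero
rev-shift (suc r) f (suc (suc n)) = rev-shift r f (suc n)

rev-step : ∀ r f → f (suc (suc r)) ≡ 0ℤ →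
           rev (suc (suc r)) f ≈ₚ const (f 0) *ₚ x^ suc (suc r) +ₚ xₚ *ₚ rev r (shift f)
rev-step r f f₂₊ᵣ≡0 = begin
  rev (suc (suc r)) f
    ≈⟨ rev-suc (suc r) f f₂₊ᵣ≡0 ⟩
  x· rev (suc r) f
    ≈⟨ xₚ*ₚ≈x· (rev (suc r) f) ⟨
  xₚ *ₚ rev (suc r) f
    ≈⟨ *ₚ-congˡ xₚ (ℙ.trans (rev-shift r f) (ℙ.+-congʳ {rev r (shift f)} (ℙ.sym (const*ₚ≈·ₚ (f 0) _)))) ⟩
  xₚ *ₚ (const (f 0) *ₚ x^ suc r +ₚ rev r (shift f))
    ≈⟨ regroup xₚ (const (f 0)) (x^ suc r) (rev r (shift f)) ⟩
  const (f 0) *ₚ (xₚ *ₚ x^ suc r) +ₚ xₚ *ₚ rev r (shift f)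
    ≈⟨ ℙ.+-congʳ {xₚ *ₚ rev r (shift f)} (*ₚ-congˡ (const (f 0)) (xₚ*ₚ≈x· (x^ suc r))) ⟩
  const (f 0) *ₚ x^ suc (suc r) +ₚ xₚ *ₚ rev r (shift f) ∎
  where
  open SetoidReasoning ℙ.setoid
  regroup : ∀ x c m q → x *ₚ (c *ₚ m +ₚ q) ≈ₚ c *ₚ (x *ₚ m) +ₚ x *ₚ q
  regroup = solve 4 (λ x c m q → x :* (c :* m :+ q) := c :* (x :* m) :+ x :* q) ℙ.refl

≈const : ∀ f → (∀ n → f (suc n) ≡ 0ℤ) → f ≈ₚ const (f 0)
≈const f f-constant zero    = sym (ℤP.*-identityʳ (f 0))
≈const f f-constant (suc n) = trans (f-constant n) (sym (ℤP.*-zeroʳ (f 0)))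

rev-constant : ∀ f → (∀ n → f (suc n) ≡ 0ℤ) → rev 0 f ≈ₚ f
rev-constant f f-constant zero    = refl
rev-constant f f-constant (suc n) = sym (f-constant n)

-- Q r f = Σᵢ fᵢ xⁱ [ r − 2i ]ₓ, which is (x^r f(x⁻¹) − f(x)) / (x − 1) when deg f ≤ r/2.
Q : ℕ → Poly → Poly
Q zero          f = 0ₚ
Q (suc zero)    f = const (f 0) *ₚ [ 1 ]ₓ
Q (suc (suc r)) f = const (f 0) *ₚ [ suc (suc r) ]ₓ +ₚ xₚ *ₚ Q r (shift f)

module _ where
  open SetoidReasoning ℙ.setoid

  x-1ₚ*Q : ∀ r f → DegLtHalf f (suc r) → x-1ₚ *ₚ Q r f ≈ₚ rev r f +ₚ -ₚ f
  x-1ₚ*Q zero f deg = begin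
    x-1ₚ *ₚ 0ₚ            ≈⟨ ℙ.zeroʳ x-1ₚ ⟩
    0ₚ                    ≈⟨ ℙ.-‿inverseʳ f ⟨
    f +ₚ -ₚ f             ≈⟨ ℙ.+-congʳ { -ₚ f} (rev-constant f (λ n → deg (suc n) (s≤s z≤n))) ⟨
    rev 0 f +ₚ -ₚ f       ∎
  x-1ₚ*Q (suc zero) f deg = begin
    x-1ₚ *ₚ (const (f 0) *ₚ [ 1 ]ₓ)
      ≈⟨ *ₚ-congˡ x-1ₚ (ℙ.trans (*ₚ-congˡ (const (f 0)) [1]ₓ≈1ₚ) (*ₚ-identityʳ (const (f 0)))) ⟩
    x-1ₚ *ₚ const (f 0)
      ≈⟨ *ₚ-congˡ x-1ₚ (≈const f f-constant) ⟨
    x-1ₚ *ₚ f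
      ≈⟨ x-1ₚ*ₚ≈x·-id f ⟩
    x· f +ₚ -ₚ f
      ≈⟨ ℙ.+-congʳ { -ₚ f} (x·-cong (rev-constant f f-constant)) ⟨
    x· rev 0 f +ₚ -ₚ f
      ≈⟨ ℙ.+-congʳ { -ₚ f} (rev-suc 0 f (f-constant 0)) ⟨
    rev 1 f +ₚ -ₚ f ∎
    where
    f-constant : ∀ n → f (suc n) ≡ 0ℤ
    f-constant n = deg (suc n) (ℕP.*-monoʳ-≤ 2 (s≤s z≤n))
  x-1ₚ*Q (suc (suc r)) f deg = begin
    x-1ₚ *ₚ (const (f 0) *ₚ [ suc (suc r) ]ₓ +ₚ xₚ *ₚ Q r (shift f))
      ≈⟨ distribute x-1ₚ (const (f 0)) [ suc (suc r) ]ₓ xₚ (Q r (shift f)) ⟩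
    const (f 0) *ₚ (x-1ₚ *ₚ [ suc (suc r) ]ₓ) +ₚ xₚ *ₚ (x-1ₚ *ₚ Q r (shift f))
      ≈⟨ ℙ.+-cong (*ₚ-congˡ (const (f 0)) (x-1ₚ*[]ₓ (suc (suc r))))
                  (*ₚ-congˡ xₚ (x-1ₚ*Q r (shift f) (λ n le → deg (suc n) (ℕP.≤-trans (s≤s (s≤s le)) (2+2n≤2[1+n] n))))) ⟩
    const (f 0) *ₚ (x^ suc (suc r) +ₚ -ₚ 1ₚ) +ₚ xₚ *ₚ (rev r (shift f) +ₚ -ₚ shift f)
      ≈⟨ collect (const (f 0)) (x^ suc (suc r)) 1ₚ xₚ (rev r (shift f)) (shift f) ⟩
    (const (f 0) *ₚ x^ suc (suc r) +ₚ xₚ *ₚ rev r (shift f)) +ₚ -ₚ (const (f 0) *ₚ 1ₚ +ₚ xₚ *ₚ shift f)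
      ≈⟨ ℙ.+-cong (ℙ.sym (rev-step r f (deg (suc (suc r)) (ℕP.m<m+n (suc (suc r)) (s≤s z≤n)))))
                  (ℙ.-‿cong (ℙ.trans (ℙ.+-cong (*ₚ-identityʳ (const (f 0))) (xₚ*ₚ≈x· (shift f))) (ℙ.sym (≈const+x·shift f)))) ⟩
    rev (suc (suc r)) f +ₚ -ₚ f ∎
    where
    2+2n≤2[1+n] : ∀ n → suc (suc (2 ℕ.* n)) ℕ.≤ 2 ℕ.* suc n
    2+2n≤2[1+n] n = ℕP.≤-reflexive (sym (ℕP.*-suc 2 n))
    distribute : ∀ y c b x q → y *ₚ (c *ₚ b +ₚ x *ₚ q) ≈ₚ c *ₚ (y *ₚ b) +ₚ x *ₚ (y *ₚ q)
    distribute = solve 5 (λ y c b x q → y :* (c :* b :+ x :* q) := c :* (y :* b) :+ x :* (y :* q)) ℙ.refl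
    collect : ∀ c m o x r g → c *ₚ (m +ₚ -ₚ o) +ₚ x *ₚ (r +ₚ -ₚ g) ≈ₚ (c *ₚ m +ₚ x *ₚ r) +ₚ -ₚ (c *ₚ o +ₚ x *ₚ g)
    collect = solve 6 (λ c m o x r g → c :* (m :- o) :+ x :* (r :- g) := (c :* m :+ x :* r) :- (c :* o :+ x :* g)) ℙ.refl

  x-1ₚ*xₚ*Q : ∀ r f → DegLtHalf f r → x-1ₚ *ₚ (xₚ *ₚ Q (r ∸ 1) f) ≈ₚ rev r f +ₚ -ₚ (xₚ *ₚ f)
  x-1ₚ*xₚ*Q zero f deg = begin
    x-1ₚ *ₚ (xₚ *ₚ 0ₚ)          ≈⟨ ℙ.trans (*ₚ-congˡ x-1ₚ (ℙ.zeroʳ xₚ)) (ℙ.zeroʳ x-1ₚ) ⟩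
    0ₚ                          ≈⟨ ℙ.-‿inverseʳ (xₚ *ₚ f) ⟨
    xₚ *ₚ f +ₚ -ₚ (xₚ *ₚ f)     ≈⟨ ℙ.+-congʳ { -ₚ (xₚ *ₚ f)} (ℙ.trans (*ₚ-congˡ xₚ f≈0) (ℙ.zeroʳ xₚ)) ⟩
    0ₚ +ₚ -ₚ (xₚ *ₚ f)          ≈⟨ ℙ.+-congʳ { -ₚ (xₚ *ₚ f)} rev0≈0 ⟨
    rev 0 f +ₚ -ₚ (xₚ *ₚ f)     ∎
    where
    f≈0 : f ≈ₚ 0ₚ
    f≈0 n = deg n z≤n
    rev0≈0 : rev 0 f ≈ₚ 0ₚ
    rev0≈0 zero    = f≈0 0
    rev0≈0 (suc n) = refl
  x-1ₚ*xₚ*Q (suc r) f deg = begin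
    x-1ₚ *ₚ (xₚ *ₚ Q r f)
      ≈⟨ ℙ.*-assoc x-1ₚ xₚ (Q r f) ⟨
    (x-1ₚ *ₚ xₚ) *ₚ Q r f
      ≈⟨ *ₚ-congʳ (Q r f) (*ₚ-comm x-1ₚ xₚ) ⟩
    (xₚ *ₚ x-1ₚ) *ₚ Q r f
      ≈⟨ ℙ.*-assoc xₚ x-1ₚ (Q r f) ⟩
    xₚ *ₚ (x-1ₚ *ₚ Q r f)
      ≈⟨ *ₚ-congˡ xₚ (x-1ₚ*Q r f deg) ⟩
    xₚ *ₚ (rev r f +ₚ -ₚ f)
      ≈⟨ ℙ.trans (ℙ.distribˡ xₚ (rev r f) (-ₚ f)) (ℙ.+-congˡ {xₚ *ₚ rev r f} (ℙ.sym (-‿distribʳ-* xₚ f))) ⟩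
    xₚ *ₚ rev r f +ₚ -ₚ (xₚ *ₚ f)
      ≈⟨ ℙ.+-congʳ { -ₚ (xₚ *ₚ f)} (ℙ.trans (xₚ*ₚ≈x· (rev r f)) (ℙ.sym (rev-suc r f (deg (suc r) (ℕP.m≤m+n _ _))))) ⟩
    rev (suc r) f +ₚ -ₚ (xₚ *ₚ f) ∎

-- Symmetric unimodal polynomials

-- SymUnimodal d p: p is a non-negative combination of the polynomials xⁱ [ d + 1 − 2i ]ₓ,
-- all of which are symmetric and unimodal about d/2.
data SymUnimodal : ℕ → Poly → Set where
  su-0     : ∀ {d} → SymUnimodal d 0ₚ
  su-block : ∀ d → SymUnimodal d [ suc d ]ₓ
  su-+     : ∀ {d p q} → SymUnimodal d p → SymUnimodal d q → SymUnimodal d (p +ₚ q)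
  su-x     : ∀ {d p} → SymUnimodal d p → SymUnimodal (suc (suc d)) (xₚ *ₚ p)
  su-scale : ∀ {d p} c → 0ℤ ℤ.≤ c → SymUnimodal d p → SymUnimodal d (const c *ₚ p)
  su-≈     : ∀ {d p q} → p ≈ₚ q → SymUnimodal d p → SymUnimodal d q

su-reindex : ∀ {d e p} → d ≡ e → SymUnimodal d p → SymUnimodal e p
su-reindex refl s = s

module _ where
  open SetoidReasoning ℙ.setoid

  []ₓ-suc-* : ∀ m q → [ suc m ]ₓ *ₚ q ≈ₚ q +ₚ xₚ *ₚ ([ m ]ₓ *ₚ q)
  []ₓ-suc-* m q = begin
    [ suc m ]ₓ *ₚ q                    ≈⟨ *ₚ-congʳ q ([]ₓ-suc m) ⟩
    (1ₚ +ₚ xₚ *ₚ [ m ]ₓ) *ₚ q          ≈⟨ ℙ.distribʳ q 1ₚ (xₚ *ₚ [ m ]ₓ) ⟩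
    1ₚ *ₚ q +ₚ (xₚ *ₚ [ m ]ₓ) *ₚ q     ≈⟨ ℙ.+-cong (*ₚ-identityˡ q) (ℙ.*-assoc xₚ [ m ]ₓ q) ⟩
    q +ₚ xₚ *ₚ ([ m ]ₓ *ₚ q)           ∎

  []ₓ*[]ₓ : ∀ m n → [ suc m ]ₓ *ₚ [ suc n ]ₓ ≈ₚ [ suc (m ℕ.+ n) ]ₓ +ₚ xₚ *ₚ ([ m ]ₓ *ₚ [ n ]ₓ)
  []ₓ*[]ₓ zero n = begin
    [ 1 ]ₓ *ₚ [ suc n ]ₓ
      ≈⟨ []ₓ-suc-* 0 [ suc n ]ₓ ⟩
    [ suc n ]ₓ +ₚ xₚ *ₚ ([ 0 ]ₓ *ₚ [ suc n ]ₓ)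
      ≈⟨ ℙ.+-congˡ {[ suc n ]ₓ} (*ₚ-congˡ xₚ (ℙ.trans (ℙ.zeroˡ [ suc n ]ₓ) (ℙ.sym (ℙ.zeroˡ [ n ]ₓ)))) ⟩
    [ suc n ]ₓ +ₚ xₚ *ₚ ([ 0 ]ₓ *ₚ [ n ]ₓ) ∎
  []ₓ*[]ₓ (suc m) n = begin
    [ suc (suc m) ]ₓ *ₚ [ suc n ]ₓ
      ≈⟨ []ₓ-suc-* (suc m) [ suc n ]ₓ ⟩
    [ suc n ]ₓ +ₚ xₚ *ₚ ([ suc m ]ₓ *ₚ [ suc n ]ₓ)
      ≈⟨ ℙ.+-cong ([]ₓ-suc n) (*ₚ-congˡ xₚ ([]ₓ*[]ₓ m n)) ⟩
    (1ₚ +ₚ xₚ *ₚ [ n ]ₓ) +ₚ xₚ *ₚ ([ suc (m ℕ.+ n) ]ₓ +ₚ xₚ *ₚ ([ m ]ₓ *ₚ [ n ]ₓ))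
      ≈⟨ regroup 1ₚ xₚ [ n ]ₓ [ suc (m ℕ.+ n) ]ₓ ([ m ]ₓ *ₚ [ n ]ₓ) ⟩
    (1ₚ +ₚ xₚ *ₚ [ suc (m ℕ.+ n) ]ₓ) +ₚ xₚ *ₚ ([ n ]ₓ +ₚ xₚ *ₚ ([ m ]ₓ *ₚ [ n ]ₓ))
      ≈⟨ ℙ.+-cong ([]ₓ-suc (suc (m ℕ.+ n))) (*ₚ-congˡ xₚ ([]ₓ-suc-* m [ n ]ₓ)) ⟨
    [ suc (suc m ℕ.+ n) ]ₓ +ₚ xₚ *ₚ ([ suc m ]ₓ *ₚ [ n ]ₓ) ∎
    where
    regroup : ∀ o x b c ab → (o +ₚ x *ₚ b) +ₚ x *ₚ (c +ₚ x *ₚ ab) ≈ₚ (o +ₚ x *ₚ c) +ₚ x *ₚ (b +ₚ x *ₚ ab)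
    regroup = solve 5 (λ o x b c ab → (o :+ x :* b) :+ x :* (c :+ x :* ab) := (o :+ x :* c) :+ x :* (b :+ x :* ab)) ℙ.refl

SymUnimodal-[]ₓ*[]ₓ : ∀ d e → SymUnimodal (d ℕ.+ e) ([ suc d ]ₓ *ₚ [ suc e ]ₓ)
SymUnimodal-[]ₓ*[]ₓ zero    e       = su-≈ (ℙ.sym ([1]ₓ-identityˡ [ suc e ]ₓ)) (su-block e)
SymUnimodal-[]ₓ*[]ₓ (suc d) zero    =
  su-reindex (sym (ℕP.+-identityʳ (suc d)))
    (su-≈ (ℙ.sym (ℙ.trans (*ₚ-comm [ suc (suc d) ]ₓ [ 1 ]ₓ) ([1]ₓ-identityˡ [ suc (suc d) ]ₓ))) (su-block (suc d)))
SymUnimodal-[]ₓ*[]ₓ (suc d) (suc e) =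
  su-≈ (ℙ.sym ([]ₓ*[]ₓ (suc d) (suc e)))
    (su-+ (su-block (suc d ℕ.+ suc e))
          (su-reindex (cong suc (sym (ℕP.+-suc d e))) (su-x (SymUnimodal-[]ₓ*[]ₓ d e))))

SymUnimodal-[]ₓ* : ∀ d {e q} → SymUnimodal e q → SymUnimodal (d ℕ.+ e) ([ suc d ]ₓ *ₚ q)
SymUnimodal-[]ₓ* d su-0 = su-≈ (ℙ.sym (ℙ.zeroʳ [ suc d ]ₓ)) su-0
SymUnimodal-[]ₓ* d (su-block e) = SymUnimodal-[]ₓ*[]ₓ d e
SymUnimodal-[]ₓ* d (su-+ {p = p} {q} s t) =
  su-≈ (ℙ.sym (ℙ.distribˡ [ suc d ]ₓ p q)) (su-+ (SymUnimodal-[]ₓ* d s) (SymUnimodal-[]ₓ* d t))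
SymUnimodal-[]ₓ* d (su-x {e} {p} s) =
  su-reindex (sym (trans (ℕP.+-suc d (suc e)) (cong suc (ℕP.+-suc d e))))
    (su-≈ (x*yz≈y*xz xₚ [ suc d ]ₓ p) (su-x (SymUnimodal-[]ₓ* d s)))
SymUnimodal-[]ₓ* d (su-scale {p = p} c c≥0 s) =
  su-≈ (x*yz≈y*xz (const c) [ suc d ]ₓ p) (su-scale c c≥0 (SymUnimodal-[]ₓ* d s))
SymUnimodal-[]ₓ* d (su-≈ p≈q s) = su-≈ (*ₚ-congˡ [ suc d ]ₓ p≈q) (SymUnimodal-[]ₓ* d s)

SymUnimodal-* : ∀ {d e p q} → SymUnimodal d p → SymUnimodal e q → SymUnimodal (d ℕ.+ e) (p *ₚ q)
SymUnimodal-* {q = q} su-0 t = su-≈ (ℙ.sym (ℙ.zeroˡ q)) su-0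
SymUnimodal-* (su-block d) t = SymUnimodal-[]ₓ* d t
SymUnimodal-* {q = r} (su-+ {p = p} {q} s s′) t =
  su-≈ (ℙ.sym (ℙ.distribʳ r p q)) (su-+ (SymUnimodal-* s t) (SymUnimodal-* s′ t))
SymUnimodal-* {q = q} (su-x {p = p} s) t = su-≈ (ℙ.sym (ℙ.*-assoc xₚ p q)) (su-x (SymUnimodal-* s t))
SymUnimodal-* {q = q} (su-scale {p = p} c c≥0 s) t =
  su-≈ (ℙ.sym (ℙ.*-assoc (const c) p q)) (su-scale c c≥0 (SymUnimodal-* s t))
SymUnimodal-* {q = q} (su-≈ p≈p′ s) t = su-≈ (*ₚ-congʳ q p≈p′) (SymUnimodal-* s t)

record UnimodalAbout (d : ℕ) (p : Poly) : Set where
  field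
    nonNeg     : NonNeg p
    increasing : ∀ k → suc (2 ℕ.* k) ℕ.≤ d → p k ℤ.≤ p (suc k)
    decreasing : ∀ k → d ℕ.≤ suc (2 ℕ.* k) → p (suc k) ℤ.≤ p k

module _ {d : ℕ} where
  open UnimodalAbout

  UnimodalAbout-≈ : ∀ {p q} → p ≈ₚ q → UnimodalAbout d p → UnimodalAbout d q
  UnimodalAbout-≈ p≈q u = record
    { nonNeg     = λ n → ℤP.≤-trans (nonNeg u n) (ℤP.≤-reflexive (p≈q n))
    ; increasing = λ k le → resp (p≈q k) (p≈q (suc k)) (increasing u k le)
    ; decreasing = λ k le → resp (p≈q (suc k)) (p≈q k) (decreasing u k le) }
    where
    resp : ∀ {a b a′ b′} → a ≡ a′ → b ≡ b′ → a ℤ.≤ b → a′ ℤ.≤ b′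
    resp refl refl a≤b = a≤b

  UnimodalAbout-0 : UnimodalAbout d 0ₚ
  UnimodalAbout-0 = record
    { nonNeg = λ _ → ℤP.≤-refl ; increasing = λ _ _ → ℤP.≤-refl ; decreasing = λ _ _ → ℤP.≤-refl }

  UnimodalAbout-+ : ∀ {p q} → UnimodalAbout d p → UnimodalAbout d q → UnimodalAbout d (p +ₚ q)
  UnimodalAbout-+ u v = record
    { nonNeg     = λ n → ℤP.+-mono-≤ {0ℤ} {_} {0ℤ} (nonNeg u n) (nonNeg v n)
    ; increasing = λ k le → ℤP.+-mono-≤ (increasing u k le) (increasing v k le)
    ; decreasing = λ k le → ℤP.+-mono-≤ (decreasing u k le) (decreasing v k le) }

  UnimodalAbout-scale : ∀ {p} c → 0ℤ ℤ.≤ c → UnimodalAbout d p → UnimodalAbout d (c ·ₚ p)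
  UnimodalAbout-scale c c≥0 u = record
    { nonNeg     = λ n → ℤP.≤-trans (ℤP.≤-reflexive (sym (ℤP.*-zeroʳ c))) (scale (nonNeg u n))
    ; increasing = λ k le → scale (increasing u k le)
    ; decreasing = λ k le → scale (decreasing u k le) }
    where
    scale : ∀ {a b} → a ℤ.≤ b → c ℤ.* a ℤ.≤ c ℤ.* b
    scale = ℤP.*-monoˡ-≤-nonNeg c {{ℤ.nonNegative c≥0}}

UnimodalAbout-x : ∀ {d p} → UnimodalAbout d p → UnimodalAbout (suc (suc d)) (x· p)
UnimodalAbout-x {d} {p} u = record { nonNeg = nonNeg′ ; increasing = increasing′ ; decreasing = decreasing′ }
  where
  open UnimodalAbout u
  nonNeg′ : NonNeg (x· p)
  nonNeg′ zero    = ℤP.≤-refl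
  nonNeg′ (suc n) = nonNeg n
  increasing′ : ∀ k → suc (2 ℕ.* k) ℕ.≤ suc (suc d) → (x· p) k ℤ.≤ (x· p) (suc k)
  increasing′ zero    _  = nonNeg 0
  increasing′ (suc k) le = increasing k (ℕP.≤-pred (ℕP.≤-pred (subst (ℕ._≤ suc (suc d)) (cong suc (ℕP.*-suc 2 k)) le)))
  decreasing′ : ∀ k → suc (suc d) ℕ.≤ suc (2 ℕ.* k) → (x· p) (suc k) ℤ.≤ (x· p) k
  decreasing′ zero    (s≤s ())
  decreasing′ (suc k) le = decreasing k (ℕP.≤-pred (ℕP.≤-pred (subst (suc (suc d) ℕ.≤_) (cong suc (ℕP.*-suc 2 k)) le)))

UnimodalAbout-[]ₓ : ∀ d → UnimodalAbout d [ suc d ]ₓ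
UnimodalAbout-[]ₓ d = record
  { nonNeg     = []ₓ-nonNeg (suc d)
  ; increasing = λ k le →
      ℤP.≤-reflexive (trans ([]ₓ-below (suc d) k (s≤s (k≤d le))) (sym ([]ₓ-below (suc d) (suc k) (s≤s (1+k≤d le)))))
  ; decreasing = λ k _ → []ₓ-antitone (suc d) k }
  where
  1+k≤d : ∀ {k} → suc (2 ℕ.* k) ℕ.≤ d → suc k ℕ.≤ d
  1+k≤d {k} le = ℕP.≤-trans (s≤s (ℕP.m≤m+n k _)) le
  k≤d : ∀ {k} → suc (2 ℕ.* k) ℕ.≤ d → k ℕ.≤ d
  k≤d le = ℕP.<⇒≤ (1+k≤d le)
  []ₓ-nonNeg : ∀ k → NonNeg [ k ]ₓ
  []ₓ-nonNeg zero    n       = ℤP.≤-refl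
  []ₓ-nonNeg (suc k) zero    = ℤ.+≤+ z≤n
  []ₓ-nonNeg (suc k) (suc n) = []ₓ-nonNeg k n
  []ₓ-below : ∀ k n → n ℕ.< k → [ k ]ₓ n ≡ 1ℤ
  []ₓ-below (suc k) zero    _        = refl
  []ₓ-below (suc k) (suc n) (s≤s lt) = []ₓ-below k n lt
  []ₓ-antitone : ∀ k n → [ k ]ₓ (suc n) ℤ.≤ [ k ]ₓ n
  []ₓ-antitone zero          n       = ℤP.≤-refl
  []ₓ-antitone (suc zero)    zero    = ℤ.+≤+ z≤n
  []ₓ-antitone (suc (suc k)) zero    = ℤP.≤-refl
  []ₓ-antitone (suc k)       (suc n) = []ₓ-antitone k n

SymUnimodal⇒UnimodalAbout : ∀ {d p} → SymUnimodal d p → UnimodalAbout d p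
SymUnimodal⇒UnimodalAbout su-0             = UnimodalAbout-0
SymUnimodal⇒UnimodalAbout (su-block d)     = UnimodalAbout-[]ₓ d
SymUnimodal⇒UnimodalAbout (su-+ s t)       = UnimodalAbout-+ (SymUnimodal⇒UnimodalAbout s) (SymUnimodal⇒UnimodalAbout t)
SymUnimodal⇒UnimodalAbout (su-x {p = p} s) =
  UnimodalAbout-≈ (ℙ.sym (xₚ*ₚ≈x· p)) (UnimodalAbout-x (SymUnimodal⇒UnimodalAbout s))
SymUnimodal⇒UnimodalAbout (su-scale {p = p} c c≥0 s) =
  UnimodalAbout-≈ (ℙ.sym (const*ₚ≈·ₚ c p)) (UnimodalAbout-scale c c≥0 (SymUnimodal⇒UnimodalAbout s))
SymUnimodal⇒UnimodalAbout (su-≈ p≈q s)     = UnimodalAbout-≈ p≈q (SymUnimodal⇒UnimodalAbout s)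

UnimodalAbout⇒Unimodal : ∀ {d p} → UnimodalAbout d p → NonNeg p × Unimodal p
UnimodalAbout⇒Unimodal {d} {p} u =
  nonNeg , ℕ.⌊ d /2⌋ , (λ i lt → increasing i (below-half d i lt)) , (λ i le → decreasing i (above-half d i le))
  where
  open UnimodalAbout u
  below-half : ∀ d i → i ℕ.< ℕ.⌊ d /2⌋ → suc (2 ℕ.* i) ℕ.≤ d
  below-half (suc (suc d)) zero    _        = s≤s z≤n
  below-half (suc (suc d)) (suc i) (s≤s lt) =
    subst (ℕ._≤ suc (suc d)) (sym (cong suc (ℕP.*-suc 2 i))) (s≤s (s≤s (below-half d i lt)))
  above-half : ∀ d i → ℕ.⌊ d /2⌋ ℕ.≤ i → d ℕ.≤ suc (2 ℕ.* i)
  above-half zero          i       _        = z≤n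
  above-half (suc zero)    i       _        = s≤s z≤n
  above-half (suc (suc d)) (suc i) (s≤s le) =
    subst (suc (suc d) ℕ.≤_) (sym (cong suc (ℕP.*-suc 2 i))) (s≤s (s≤s (above-half d i le)))

UnimodalAbout-stable : ∀ {d p} → ¬ ¬ UnimodalAbout d p → UnimodalAbout d p
UnimodalAbout-stable ¬¬u = record
  { nonNeg     = λ n → stable (λ ¬≤ → ¬¬u (λ u → ¬≤ (UnimodalAbout.nonNeg u n)))
  ; increasing = λ k le → stable (λ ¬≤ → ¬¬u (λ u → ¬≤ (UnimodalAbout.increasing u k le)))
  ; decreasing = λ k le → stable (λ ¬≤ → ¬¬u (λ u → ¬≤ (UnimodalAbout.decreasing u k le))) }
  where
  stable : ∀ {a b} → ¬ ¬ (a ℤ.≤ b) → a ℤ.≤ b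
  stable {a} {b} = decidable-stable (a ℤP.≤? b)

SymUnimodal-Q : ∀ r f → NonNeg f → SymUnimodal (r ∸ 1) (Q r f)
SymUnimodal-Q zero                f f≥0 = su-0
SymUnimodal-Q (suc zero)          f f≥0 = su-scale (f 0) (f≥0 0) (su-block 0)
SymUnimodal-Q (suc (suc zero))    f f≥0 =
  su-+ (su-scale (f 0) (f≥0 0) (su-block 1)) (su-≈ (ℙ.sym (ℙ.zeroʳ xₚ)) su-0)
SymUnimodal-Q (suc (suc (suc r))) f f≥0 =
  su-+ (su-scale (f 0) (f≥0 0) (su-block (suc (suc r)))) (su-x (SymUnimodal-Q (suc r) (shift f) (f≥0 ∘ suc)))

SymUnimodal-xₚ*Q : ∀ r f → NonNeg f → SymUnimodal r (xₚ *ₚ Q (r ∸ 1) f)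
SymUnimodal-xₚ*Q zero          f f≥0 = su-≈ (ℙ.sym (ℙ.zeroʳ xₚ)) su-0
SymUnimodal-xₚ*Q (suc zero)    f f≥0 = su-≈ (ℙ.sym (ℙ.zeroʳ xₚ)) su-0
SymUnimodal-xₚ*Q (suc (suc r)) f f≥0 = su-x (SymUnimodal-Q (suc r) f f≥0)

-- Finite sums

module _ {a : Level} {A : Set a} where

  Σₚ : (A → Poly) → List A → Poly
  Σₚ F L = sumₚ (map F L)

  Σₚ-cong : ∀ {F G : A → Poly} L → (∀ {w} → w ∈ L → F w ≈ₚ G w) → Σₚ F L ≈ₚ Σₚ G L
  Σₚ-cong []      F≈G = ℙ.refl
  Σₚ-cong (x ∷ L) F≈G = ℙ.+-cong (F≈G (here refl)) (Σₚ-cong L (F≈G ∘ there))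

  Σₚ-0 : ∀ {F : A → Poly} L → (∀ {w} → w ∈ L → F w ≈ₚ 0ₚ) → Σₚ F L ≈ₚ 0ₚ
  Σₚ-0 []      F≈0 = ℙ.refl
  Σₚ-0 (x ∷ L) F≈0 = ℙ.trans (ℙ.+-cong (F≈0 (here refl)) (Σₚ-0 L (F≈0 ∘ there))) (ℙ.+-identityʳ 0ₚ)

  Σₚ-++ : ∀ (F : A → Poly) L L′ → Σₚ F (L ++ L′) ≈ₚ Σₚ F L +ₚ Σₚ F L′
  Σₚ-++ F []      L′ = ℙ.sym (ℙ.+-identityˡ _)
  Σₚ-++ F (x ∷ L) L′ = ℙ.trans (ℙ.+-congˡ {F x} (Σₚ-++ F L L′)) (ℙ.sym (ℙ.+-assoc (F x) _ _))

  Σₚ-*ˡ : ∀ p (F : A → Poly) L → p *ₚ Σₚ F L ≈ₚ Σₚ (λ w → p *ₚ F w) L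
  Σₚ-*ˡ p F []      = ℙ.zeroʳ p
  Σₚ-*ˡ p F (x ∷ L) = ℙ.trans (ℙ.distribˡ p (F x) (Σₚ F L)) (ℙ.+-congˡ {p *ₚ F x} (Σₚ-*ˡ p F L))

  Σₚ-*ʳ : ∀ p (F : A → Poly) L → Σₚ F L *ₚ p ≈ₚ Σₚ (λ w → F w *ₚ p) L
  Σₚ-*ʳ p F []      = ℙ.zeroˡ p
  Σₚ-*ʳ p F (x ∷ L) = ℙ.trans (ℙ.distribʳ p (F x) (Σₚ F L)) (ℙ.+-congˡ {F x *ₚ p} (Σₚ-*ʳ p F L))

  Σₚ-neg : ∀ (F : A → Poly) L → -ₚ Σₚ F L ≈ₚ Σₚ (λ w → -ₚ F w) L
  Σₚ-neg F []      = λ _ → refl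
  Σₚ-neg F (x ∷ L) = ℙ.trans (ℙ.sym (-‿+-comm (F x) (Σₚ F L))) (ℙ.+-congˡ { -ₚ F x} (Σₚ-neg F L))

  Σₚ-↭ : ∀ (F : A → Poly) {L L′} → L ↭ L′ → Σₚ F L ≈ₚ Σₚ F L′
  Σₚ-↭ F ↭.refl          = ℙ.refl
  Σₚ-↭ F (↭.prep x p)    = ℙ.+-congˡ {F x} (Σₚ-↭ F p)
  Σₚ-↭ F (↭.swap x y p)  = ℙ.trans (ℙ.+-congˡ {F x} (ℙ.+-congˡ {F y} (Σₚ-↭ F p))) (x+yz≈y+xz (F x) (F y) _)
  Σₚ-↭ F (↭.trans p p′)  = ℙ.trans (Σₚ-↭ F p) (Σₚ-↭ F p′)

  Σₚ-set-cong : ∀ (F : A → Poly) {L L′} → Unique L → Unique L′ → (∀ {w} → w ∈ L ⇔ w ∈ L′) → Σₚ F L ≈ₚ Σₚ F L′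
  Σₚ-set-cong F u u′ same = Σₚ-↭ F (∼bag⇒↭ (unique∧set⇒bag u u′ same))

  SymUnimodal-Σₚ : ∀ {d} {F : A → Poly} L → (∀ {w} → w ∈ L → SymUnimodal d (F w)) → SymUnimodal d (Σₚ F L)
  SymUnimodal-Σₚ []      _  = su-0
  SymUnimodal-Σₚ (x ∷ L) sF = su-+ (sF (here refl)) (SymUnimodal-Σₚ L (sF ∘ there))

  Unique-resp-↭ : ∀ {L L′ : List A} → Unique L → L ↭ L′ → Unique L′
  Unique-resp-↭ u                           ↭.refl         = u
  Unique-resp-↭ (x≢L ∷ u)                   (↭.prep x p)   = All-resp-↭ p x≢L ∷ Unique-resp-↭ u p
  Unique-resp-↭ ((x≢y ∷ x≢L) ∷ (y≢L ∷ u))  (↭.swap x y p) =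
    ((x≢y ∘ sym) ∷ All-resp-↭ p y≢L) ∷ (All-resp-↭ p x≢L ∷ Unique-resp-↭ u p)
  Unique-resp-↭ u                           (↭.trans p p′) = Unique-resp-↭ (Unique-resp-↭ u p) p′

  record Removal (L : List A) (x : A) : Set a where
    field
      rest        : List A
      Σₚ-split    : ∀ F → Σₚ F L ≈ₚ F x +ₚ Σₚ F rest
      rest-unique : Unique rest
      ∈-rest      : ∀ {w} → w ∈ rest ⇔ (w ∈ L × w ≢ x)

  removal-middle : ∀ ys {x} zs → Unique (ys ++ x ∷ zs) → Removal (ys ++ x ∷ zs) x
  removal-middle ys {x} zs u with x∉rest ∷ rest-unique ← Unique-resp-↭ u (↭-shift x ys zs) = record
    { rest        = ys ++ zs
    ; Σₚ-split    = λ F → Σₚ-↭ F (↭-shift x ys zs)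
    ; rest-unique = rest-unique
    ; ∈-rest      = mk⇔ (λ w∈rest → ∈-resp-↭ (↭-sym (↭-shift x ys zs)) (there w∈rest) ,
                                    λ w≡x → All.lookup x∉rest w∈rest (sym w≡x))
                        (λ (w∈L , w≢x) → in-rest (∈-resp-↭ (↭-shift x ys zs) w∈L) w≢x) }
    where
    in-rest : ∀ {w} → w ∈ x ∷ ys ++ zs → w ≢ x → w ∈ ys ++ zs
    in-rest (here w≡x)     w≢x = ⊥-elim (w≢x w≡x)
    in-rest (there w∈rest) _   = w∈rest

  removal : ∀ {L x} → Unique L → x ∈ L → Removal L x
  removal u x∈L with ys , zs , refl ← ∈-∃++ x∈L = removal-middle ys zs u

Σₚ-map : ∀ {a b} {A : Set a} {B : Set b} (F : B → Poly) (h : A → B) L → Σₚ F (map h L) ≈ₚ Σₚ (F ∘ h) L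
Σₚ-map F h L = ℙ.reflexive (cong sumₚ (sym (map-∘ L)))

module _ {a b : Level} {A : Set a} {B : Set b} where

  pairs : List A → (A → List B) → List (A × B)
  pairs []      g = []
  pairs (x ∷ L) g = map (x ,_) (g x) ++ pairs L g

  Σₚ-pairs : ∀ (G : A → B → Poly) L g → Σₚ (uncurry G) (pairs L g) ≈ₚ Σₚ (λ x → Σₚ (G x) (g x)) L
  Σₚ-pairs G []      g = ℙ.refl
  Σₚ-pairs G (x ∷ L) g = ℙ.trans (Σₚ-++ (uncurry G) (map (x ,_) (g x)) (pairs L g))
                                 (ℙ.+-cong (Σₚ-map (uncurry G) (x ,_) (g x)) (Σₚ-pairs G L g))

  ∈-pairs⁺ : ∀ L g {x y} → x ∈ L → y ∈ g x → (x , y) ∈ pairs L g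
  ∈-pairs⁺ (x ∷ L) g (here refl) y∈gx = ∈-++⁺ˡ (∈-map⁺ (x ,_) y∈gx)
  ∈-pairs⁺ (z ∷ L) g (there x∈L) y∈gx = ∈-++⁺ʳ (map (z ,_) (g z)) (∈-pairs⁺ L g x∈L y∈gx)

  ∈-pairs⁻ : ∀ L g {x y} → (x , y) ∈ pairs L g → x ∈ L × y ∈ g x
  ∈-pairs⁻ (z ∷ L) g xy∈ with ∈-++⁻ (map (z ,_) (g z)) xy∈
  ... | inj₁ xy∈zg with _ , y∈gz , refl ← ∈-map⁻ (z ,_) xy∈zg = here refl , y∈gz
  ... | inj₂ xy∈L  with x∈L , y∈gx ← ∈-pairs⁻ L g xy∈L = there x∈L , y∈gx

  pairs-unique : ∀ L g → Unique L → (∀ x → Unique (g x)) → Unique (pairs L g)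
  pairs-unique []      g _           _  = []
  pairs-unique (x ∷ L) g (x∉L ∷ u) ug =
    UniqueP.++⁺ (UniqueP.map⁺ (cong proj₂) (ug x)) (pairs-unique L g u ug) disjoint
    where
    disjoint : ∀ {p} → p ∈ map (x ,_) (g x) × p ∈ pairs L g → ⊥
    disjoint (p∈xg , p∈L) with _ , _ , refl ← ∈-map⁻ (x ,_) p∈xg = All.lookup x∉L (proj₁ (∈-pairs⁻ L g p∈L)) refl

module _ {a b : Level} {A : Set a} {B : Set b} where

  Σₚ-swap : ∀ (G : A → B → Poly) L₁ g₁ L₂ g₂ →
            Unique L₁ → (∀ x → Unique (g₁ x)) → Unique L₂ → (∀ y → Unique (g₂ y)) →
            (∀ {x y} → (x ∈ L₁ × y ∈ g₁ x) ⇔ (y ∈ L₂ × x ∈ g₂ y)) →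
            Σₚ (λ x → Σₚ (G x) (g₁ x)) L₁ ≈ₚ Σₚ (λ y → Σₚ (λ x → G x y) (g₂ y)) L₂
  Σₚ-swap G L₁ g₁ L₂ g₂ u₁ ug₁ u₂ ug₂ same = begin
    Σₚ (λ x → Σₚ (G x) (g₁ x)) L₁
      ≈⟨ Σₚ-pairs G L₁ g₁ ⟨
    Σₚ (uncurry G) (pairs L₁ g₁)
      ≈⟨ Σₚ-set-cong (uncurry G) (pairs-unique L₁ g₁ u₁ ug₁) swapped-unique (mk⇔ to from) ⟩
    Σₚ (uncurry G) (map swap (pairs L₂ g₂))
      ≈⟨ Σₚ-map (uncurry G) swap (pairs L₂ g₂) ⟩
    Σₚ (uncurry (flip G)) (pairs L₂ g₂)
      ≈⟨ Σₚ-pairs (flip G) L₂ g₂ ⟩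
    Σₚ (λ y → Σₚ (λ x → G x y) (g₂ y)) L₂ ∎
    where
    open SetoidReasoning ℙ.setoid
    swapped-unique : Unique (map swap (pairs L₂ g₂))
    swapped-unique = UniqueP.map⁺ (cong swap) (pairs-unique L₂ g₂ u₂ ug₂)
    to : ∀ {p} → p ∈ pairs L₁ g₁ → p ∈ map swap (pairs L₂ g₂)
    to {x , y} p∈ with y∈L₂ , x∈g₂y ← Equivalence.to same (∈-pairs⁻ L₁ g₁ p∈) = ∈-map⁺ swap (∈-pairs⁺ L₂ g₂ y∈L₂ x∈g₂y)
    from : ∀ {p} → p ∈ map swap (pairs L₂ g₂) → p ∈ pairs L₁ g₁
    from p∈ with (y , x) , q∈ , refl ← ∈-map⁻ swap p∈ with x∈L₁ , y∈g₁x ← Equivalence.from same (∈-pairs⁻ L₂ g₂ q∈) =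
      ∈-pairs⁺ L₁ g₁ x∈L₁ y∈g₁x

-- The incidence algebra

module IncidenceAlgebra {c ℓ : Level} (P : LocallyFinitePoset c ℓ) where
  open LocallyFinitePoset P
  private
    module ≤ = IsPartialOrder isPartialOrder

  infixl 7 _⋆_
  _⋆_ : Inc P → Inc P → Inc P
  _⋆_ = _⊛_ P

  ∈-interval⁺ : ∀ {s t w} → s ≤ w → w ≤ t → w ∈ interval s t
  ∈-interval⁺ {s} {t} {w} s≤w w≤t = Equivalence.from (interval-mem s t w) (s≤w , w≤t)

  ∈-interval⁻ : ∀ {s t w} → w ∈ interval s t → s ≤ w × w ≤ t
  ∈-interval⁻ {s} {t} {w} = Equivalence.to (interval-mem s t w)

  Σₚ-interval-swap : ∀ (G : Carrier → Carrier → Poly) s t →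
    Σₚ (λ w → Σₚ (G w) (interval w t)) (interval s t) ≈ₚ Σₚ (λ v → Σₚ (λ w → G w v) (interval s v)) (interval s t)
  Σₚ-interval-swap G s t =
    Σₚ-swap G (interval s t) (λ w → interval w t) (interval s t) (interval s)
      (interval-unique s t) (λ w → interval-unique w t) (interval-unique s t) (interval-unique s)
      (mk⇔ to from)
    where
    to : ∀ {w v} → w ∈ interval s t × v ∈ interval w t → v ∈ interval s t × w ∈ interval s v
    to (w∈ , v∈) with s≤w , w≤t ← ∈-interval⁻ w∈ | w≤v , v≤t ← ∈-interval⁻ v∈ =
      ∈-interval⁺ (≤.trans s≤w w≤v) v≤t , ∈-interval⁺ s≤w w≤v
    from : ∀ {w v} → v ∈ interval s t × w ∈ interval s v → w ∈ interval s t × v ∈ interval w t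
    from (v∈ , w∈) with s≤v , v≤t ← ∈-interval⁻ v∈ | s≤w , w≤v ← ∈-interval⁻ w∈ =
      ∈-interval⁺ s≤w (≤.trans w≤v v≤t) , ∈-interval⁺ w≤v v≤t

  ⋆-assoc : ∀ a b d s t → ((a ⋆ b) ⋆ d) s t ≈ₚ (a ⋆ (b ⋆ d)) s t
  ⋆-assoc a b d s t = begin
    Σₚ (λ v → (a ⋆ b) s v *ₚ d v t) (interval s t)
      ≈⟨ Σₚ-cong (interval s t) (λ {v} _ → Σₚ-*ʳ (d v t) (λ w → a s w *ₚ b w v) (interval s v)) ⟩
    Σₚ (λ v → Σₚ (λ w → (a s w *ₚ b w v) *ₚ d v t) (interval s v)) (interval s t)
      ≈⟨ Σₚ-interval-swap (λ w v → (a s w *ₚ b w v) *ₚ d v t) s t ⟨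
    Σₚ (λ w → Σₚ (λ v → (a s w *ₚ b w v) *ₚ d v t) (interval w t)) (interval s t)
      ≈⟨ Σₚ-cong (interval s t) (λ {w} _ → ℙ.trans (Σₚ-cong (interval w t) (λ {v} _ → ℙ.*-assoc (a s w) (b w v) (d v t)))
                                                    (ℙ.sym (Σₚ-*ˡ (a s w) (λ v → b w v *ₚ d v t) (interval w t)))) ⟩
    Σₚ (λ w → a s w *ₚ (b ⋆ d) w t) (interval s t) ∎
    where open SetoidReasoning ℙ.setoid

  ⋆-congʳ : ∀ a b b′ s t → (∀ {w} → s ≤ w → w ≤ t → b w t ≈ₚ b′ w t) → (a ⋆ b) s t ≈ₚ (a ⋆ b′) s t
  ⋆-congʳ a b b′ s t b≈b′ = Σₚ-cong (interval s t) (λ {w} w∈ → *ₚ-congˡ (a s w) (uncurry b≈b′ (∈-interval⁻ w∈)))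

  ⋆-*ʳ : ∀ a b u s t → (a ⋆ (λ w v → u *ₚ b w v)) s t ≈ₚ u *ₚ (a ⋆ b) s t
  ⋆-*ʳ a b u s t = ℙ.trans (Σₚ-cong (interval s t) (λ {w} _ → x*yz≈y*xz (a s w) u (b w t)))
                           (ℙ.sym (Σₚ-*ˡ u (λ w → a s w *ₚ b w t) (interval s t)))

  ⋆-negˡ : ∀ a b s t → ((λ v w → -ₚ a v w) ⋆ b) s t ≈ₚ -ₚ (a ⋆ b) s t
  ⋆-negˡ a b s t = ℙ.trans (Σₚ-cong (interval s t) (λ {w} _ → ℙ.sym (-‿distribˡ-* (a s w) (b w t))))
                           (ℙ.sym (Σₚ-neg (λ w → a s w *ₚ b w t) (interval s t)))

  interval-split-first : ∀ {s t} → s ≤ t →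
    Σ[ R ∈ List Carrier ] ((∀ {w} → w ∈ R → s < w × w ≤ t) × (∀ F → Σₚ F (interval s t) ≈ₚ F s +ₚ Σₚ F R))
  interval-split-first {s} {t} s≤t = rest , in-rest , Σₚ-split
    where
    open Removal (removal (interval-unique s t) (∈-interval⁺ ≤.refl s≤t))
    in-rest : ∀ {w} → w ∈ rest → s < w × w ≤ t
    in-rest w∈ with w∈I , w≢s ← Equivalence.to ∈-rest w∈ with s≤w , w≤t ← ∈-interval⁻ w∈I =
      (s≤w , w≢s ∘ sym) , w≤t

  interval-split-ends : ∀ {s t} → s < t →
    Σ[ R ∈ List Carrier ] ((∀ {w} → w ∈ R → s < w × w < t) × (∀ F → Σₚ F (interval s t) ≈ₚ F s +ₚ (F t +ₚ Σₚ F R)))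
  interval-split-ends {s} {t} (s≤t , s≢t) = R₂.rest , in-R₂ , λ F → ℙ.trans (R₁.Σₚ-split F) (ℙ.+-congˡ {F s} (R₂.Σₚ-split F))
    where
    module R₁ = Removal (removal (interval-unique s t) (∈-interval⁺ ≤.refl s≤t))
    t∈R₁ : t ∈ R₁.rest
    t∈R₁ = Equivalence.from R₁.∈-rest (∈-interval⁺ s≤t ≤.refl , s≢t ∘ sym)
    module R₂ = Removal (removal R₁.rest-unique t∈R₁)
    in-R₂ : ∀ {w} → w ∈ R₂.rest → s < w × w < t
    in-R₂ w∈ with w∈R₁ , w≢t ← Equivalence.to R₂.∈-rest w∈
             with w∈I , w≢s ← Equivalence.to R₁.∈-rest w∈R₁
             with s≤w , w≤t ← ∈-interval⁻ w∈I =
      (s≤w , w≢s ∘ sym) , (w≤t , w≢t)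

  IsDelta-⋆ : ∀ {a} b → IsDelta P a → ∀ {s t} → s ≤ t → (a ⋆ b) s t ≈ₚ b s t
  IsDelta-⋆ {a} b (a-diag , a-off) {s} {t} s≤t with R , in-R , split ← interval-split-first s≤t = begin
    (a ⋆ b) s t
      ≈⟨ split (λ w → a s w *ₚ b w t) ⟩
    a s s *ₚ b s t +ₚ Σₚ (λ w → a s w *ₚ b w t) R
      ≈⟨ ℙ.+-cong (ℙ.trans (*ₚ-congʳ (b s t) (a-diag s)) (*ₚ-identityˡ (b s t))) (Σₚ-0 R off-diagonal) ⟩
    b s t +ₚ 0ₚ
      ≈⟨ ℙ.+-identityʳ (b s t) ⟩
    b s t ∎
    where
    open SetoidReasoning ℙ.setoid
    off-diagonal : ∀ {w} → w ∈ R → a s w *ₚ b w t ≈ₚ 0ₚ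
    off-diagonal {w} w∈R = ℙ.trans (*ₚ-congʳ (b w t) (a-off s w (proj₁ (in-R w∈R)))) (ℙ.zeroˡ (b w t))

  ⋆-diag : ∀ a b s → (a ⋆ b) s s ≈ₚ a s s *ₚ b s s
  ⋆-diag a b s with R , in-R , split ← interval-split-first (≤.refl {s}) =
    ℙ.trans (split (λ w → a s w *ₚ b w s))
            (ℙ.trans (ℙ.+-congˡ {a s s *ₚ b s s} (Σₚ-0 R (λ w∈R → ⊥-elim (empty (in-R w∈R))))) (ℙ.+-identityʳ _))
    where
    empty : ∀ {w} → s < w × w ≤ s → ⊥
    empty ((s≤w , s≢w) , w≤s) = s≢w (≤.antisym s≤w w≤s)

-- The Chow function

ρ-diag : ∀ {c ℓ} {P : LocallyFinitePoset c ℓ} (R : WeakRank P) s → WeakRank.ρ R s s ≡ 0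
ρ-diag {P = P} R s = sym (ℕP.+-cancelˡ-≡ (ρ s s) 0 (ρ s s) (trans (ℕP.+-identityʳ (ρ s s)) (additive s s s refl-s refl-s)))
  where
  open WeakRank R
  refl-s : LocallyFinitePoset._≤_ P s s
  refl-s = IsPartialOrder.refl (LocallyFinitePoset.isPartialOrder P)

module ChowFunction {c ℓ : Level} (P : LocallyFinitePoset c ℓ) (R : WeakRank P) {κ f H : Inc P}
                    (κ-diag : ∀ s → κ s s ≈ₚ 1ₚ) (right-KLS : IsRightKLS P R κ f) (chow : IsChow P R κ H) where
  open LocallyFinitePoset P
  open WeakRank R
  open IncidenceAlgebra P

  κ̄ : Inc P
  κ̄ = proj₁ chow

  private
    κ̄-diag : ∀ s → κ̄ s s ≈ₚ -1ₚ
    κ̄-diag = proj₁ (proj₁ (proj₂ chow))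
    x-1ₚ*κ̄ : ∀ s t → s < t → x-1ₚ *ₚ κ̄ s t ≈ₚ κ s t
    x-1ₚ*κ̄ = proj₂ (proj₁ (proj₂ chow))
    -H⋆κ̄≈δ : IsDelta P ((λ s t → -ₚ H s t) ⋆ κ̄)
    -H⋆κ̄≈δ = proj₂ (proj₂ (proj₂ chow))
    f-diag : ∀ s → f s s ≈ₚ 1ₚ
    f-diag = proj₁ (proj₂ right-KLS)
    f-deg : ∀ s t → s < t → DegLtHalf (f s t) (ρ s t)
    f-deg = proj₁ (proj₂ (proj₂ right-KLS))
    f-rev : ∀ s t → s ≤ t → revInc P R f s t ≈ₚ (κ ⋆ f) s t
    f-rev = proj₂ (proj₂ (proj₂ right-KLS))

  H-diag : ∀ s → H s s ≈ₚ 1ₚ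
  H-diag s = begin
    H s s                              ≈⟨ ℙ.sym (-‿involutive (H s s)) ⟩
    -ₚ (-ₚ H s s)                      ≈⟨ ℙ.-‿cong (*ₚ-identityʳ (-ₚ H s s)) ⟨
    -ₚ (-ₚ H s s *ₚ 1ₚ)                ≈⟨ -‿distribʳ-* (-ₚ H s s) 1ₚ ⟩
    -ₚ H s s *ₚ -ₚ 1ₚ                  ≈⟨ *ₚ-congˡ (-ₚ H s s) (ℙ.trans (ℙ.sym -1ₚ≈-ₚ1ₚ) (ℙ.sym (κ̄-diag s))) ⟩
    -ₚ H s s *ₚ κ̄ s s                  ≈⟨ ⋆-diag (λ s t → -ₚ H s t) κ̄ s ⟨
    ((λ s t → -ₚ H s t) ⋆ κ̄) s s       ≈⟨ proj₁ -H⋆κ̄≈δ s ⟩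
    1ₚ                                 ∎
    where open SetoidReasoning ℙ.setoid

  κ⋆ : ∀ b {s t} → s ≤ t → (κ ⋆ b) s t ≈ₚ xₚ *ₚ b s t +ₚ x-1ₚ *ₚ (κ̄ ⋆ b) s t
  κ⋆ b {s} {t} s≤t with R , in-R , split ← interval-split-first s≤t = begin
    (κ ⋆ b) s t
      ≈⟨ split (λ w → κ s w *ₚ b w t) ⟩
    κ s s *ₚ b s t +ₚ Σₚ (λ w → κ s w *ₚ b w t) R
      ≈⟨ ℙ.+-cong (ℙ.trans (*ₚ-congʳ (b s t) (κ-diag s)) (*ₚ-identityˡ (b s t))) off-diagonal ⟩
    b s t +ₚ x-1ₚ *ₚ S
      ≈⟨ regroup (b s t) x-1ₚ S ⟩
    (x-1ₚ *ₚ b s t +ₚ b s t) +ₚ x-1ₚ *ₚ (-ₚ b s t +ₚ S)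
      ≈⟨ ℙ.+-cong (ℙ.trans (ℙ.+-comm (x-1ₚ *ₚ b s t) (b s t)) (ℙ.sym (xₚ*ₚ≈id+x-1ₚ*ₚ (b s t))))
                  (*ₚ-congˡ x-1ₚ (ℙ.trans (ℙ.+-congʳ {S} κ̄-diag-term) (ℙ.sym (split (λ w → κ̄ s w *ₚ b w t))))) ⟩
    xₚ *ₚ b s t +ₚ x-1ₚ *ₚ (κ̄ ⋆ b) s t ∎
    where
    open SetoidReasoning ℙ.setoid
    S : Poly
    S = Σₚ (λ w → κ̄ s w *ₚ b w t) R
    off-diagonal : Σₚ (λ w → κ s w *ₚ b w t) R ≈ₚ x-1ₚ *ₚ S
    off-diagonal = ℙ.trans (Σₚ-cong R (λ {w} w∈R → ℙ.trans (*ₚ-congʳ (b w t) (ℙ.sym (x-1ₚ*κ̄ s w (proj₁ (in-R w∈R)))))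
                                                            (ℙ.*-assoc x-1ₚ (κ̄ s w) (b w t))))
                           (ℙ.sym (Σₚ-*ˡ x-1ₚ (λ w → κ̄ s w *ₚ b w t) R))
    κ̄-diag-term : -ₚ b s t ≈ₚ κ̄ s s *ₚ b s t
    κ̄-diag-term = ℙ.sym (ℙ.trans (*ₚ-congʳ (b s t) (ℙ.trans (κ̄-diag s) -1ₚ≈-ₚ1ₚ)) (-1*x≈-x (b s t)))
    regroup : ∀ b y S → b +ₚ y *ₚ S ≈ₚ (y *ₚ b +ₚ b) +ₚ y *ₚ (-ₚ b +ₚ S)
    regroup = solve 3 (λ b y S → b :+ y :* S := (y :* b :+ b) :+ y :* (:- b :+ S)) ℙ.refl

  M : Inc P
  M w t = rev (ρ w t) (f w t) +ₚ -ₚ (xₚ *ₚ f w t)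

  M≈x-1ₚ*κ̄⋆f : ∀ {w t} → w ≤ t → M w t ≈ₚ x-1ₚ *ₚ (κ̄ ⋆ f) w t
  M≈x-1ₚ*κ̄⋆f {w} {t} w≤t = begin
    rev (ρ w t) (f w t) +ₚ -ₚ (xₚ *ₚ f w t)
      ≈⟨ ℙ.+-congʳ { -ₚ (xₚ *ₚ f w t)} (ℙ.trans (f-rev w t w≤t) (κ⋆ f w≤t)) ⟩
    (xₚ *ₚ f w t +ₚ x-1ₚ *ₚ (κ̄ ⋆ f) w t) +ₚ -ₚ (xₚ *ₚ f w t)
      ≈⟨ cancel (xₚ *ₚ f w t) (x-1ₚ *ₚ (κ̄ ⋆ f) w t) ⟩
    x-1ₚ *ₚ (κ̄ ⋆ f) w t ∎
    where
    open SetoidReasoning ℙ.setoid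
    cancel : ∀ a b → (a +ₚ b) +ₚ -ₚ a ≈ₚ b
    cancel = solve 2 (λ a b → (a :+ b) :- a := b) ℙ.refl

  H⋆M : ∀ {s t} → s ≤ t → (H ⋆ M) s t ≈ₚ -ₚ (x-1ₚ *ₚ f s t)
  H⋆M {s} {t} s≤t = begin
    (H ⋆ M) s t
      ≈⟨ ⋆-congʳ H M (λ w v → x-1ₚ *ₚ (κ̄ ⋆ f) w v) s t (λ _ w≤t → M≈x-1ₚ*κ̄⋆f w≤t) ⟩
    (H ⋆ (λ w v → x-1ₚ *ₚ (κ̄ ⋆ f) w v)) s t
      ≈⟨ ⋆-*ʳ H (κ̄ ⋆ f) x-1ₚ s t ⟩
    x-1ₚ *ₚ (H ⋆ (κ̄ ⋆ f)) s t
      ≈⟨ *ₚ-congˡ x-1ₚ H⋆κ̄⋆f ⟩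
    x-1ₚ *ₚ -ₚ f s t
      ≈⟨ -‿distribʳ-* x-1ₚ (f s t) ⟨
    -ₚ (x-1ₚ *ₚ f s t) ∎
    where
    open SetoidReasoning ℙ.setoid
    H⋆κ̄⋆f : (H ⋆ (κ̄ ⋆ f)) s t ≈ₚ -ₚ f s t
    H⋆κ̄⋆f = begin
      (H ⋆ (κ̄ ⋆ f)) s t                                ≈⟨ -‿involutive _ ⟨
      -ₚ (-ₚ (H ⋆ (κ̄ ⋆ f)) s t)                        ≈⟨ ℙ.-‿cong (⋆-negˡ H (κ̄ ⋆ f) s t) ⟨
      -ₚ (((λ v w → -ₚ H v w) ⋆ (κ̄ ⋆ f)) s t)          ≈⟨ ℙ.-‿cong (⋆-assoc (λ v w → -ₚ H v w) κ̄ f s t) ⟨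
      -ₚ ((((λ v w → -ₚ H v w) ⋆ κ̄) ⋆ f) s t)          ≈⟨ ℙ.-‿cong (IsDelta-⋆ f -H⋆κ̄≈δ s≤t) ⟩
      -ₚ f s t                                         ∎

  record Recursion (s t : Carrier) : Set (c ⊔ ℓ) where
    field
      interior   : List Carrier
      ∈-interior : ∀ {w} → w ∈ interior → s < w × w < t
      H≈         : H s t ≈ₚ Q (ρ s t) (f s t) +ₚ Σₚ (λ w → H s w *ₚ (xₚ *ₚ Q (ρ w t ∸ 1) (f w t))) interior

  chow-recursion : ∀ {s t} → s < t → Recursion s t
  chow-recursion {s} {t} s<t with I , in-I , split ← interval-split-ends s<t = record
    { interior   = I
    ; ∈-interior = in-I
    ; H≈         = x-1ₚ*ₚ-cancelˡ (H s t) (Qst +ₚ T) (solve-for-H x-1ₚ (f s t) Qst (H s t) T equation) }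
    where
    open SetoidReasoning ℙ.setoid
    Qst T : Poly
    Qst = Q (ρ s t) (f s t)
    T   = Σₚ (λ w → H s w *ₚ (xₚ *ₚ Q (ρ w t ∸ 1) (f w t))) I
    M-st : M s t ≈ₚ x-1ₚ *ₚ (Qst +ₚ -ₚ f s t)
    M-st = begin
      rev (ρ s t) (f s t) +ₚ -ₚ (xₚ *ₚ f s t)
        ≈⟨ ℙ.+-cong (ℙ.trans (rebracket (rev (ρ s t) (f s t)) (f s t))
                             (ℙ.+-congʳ {f s t} (ℙ.sym (x-1ₚ*Q (ρ s t) (f s t) deg))))
                    (ℙ.-‿cong (xₚ*ₚ≈id+x-1ₚ*ₚ (f s t))) ⟩
      (x-1ₚ *ₚ Qst +ₚ f s t) +ₚ -ₚ (f s t +ₚ x-1ₚ *ₚ f s t)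
        ≈⟨ collect x-1ₚ Qst (f s t) ⟩
      x-1ₚ *ₚ (Qst +ₚ -ₚ f s t) ∎
      where
      deg : DegLtHalf (f s t) (suc (ρ s t))
      deg n le = f-deg s t s<t n (ℕP.≤-trans (ℕP.n≤1+n _) le)
      rebracket : ∀ r g → r ≈ₚ (r +ₚ -ₚ g) +ₚ g
      rebracket = solve 2 (λ r g → r := (r :- g) :+ g) ℙ.refl
      collect : ∀ y q g → (y *ₚ q +ₚ g) +ₚ -ₚ (g +ₚ y *ₚ g) ≈ₚ y *ₚ (q +ₚ -ₚ g)
      collect = solve 3 (λ y q g → (y :* q :+ g) :- (g :+ y :* g) := y :* (q :- g)) ℙ.refl
    M-tt : M t t ≈ₚ -ₚ x-1ₚ
    M-tt = begin
      rev (ρ t t) (f t t) +ₚ -ₚ (xₚ *ₚ f t t)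
        ≈⟨ ℙ.+-cong rev-tt (ℙ.-‿cong (ℙ.trans (*ₚ-congˡ xₚ (f-diag t)) (*ₚ-identityʳ xₚ))) ⟩
      1ₚ +ₚ -ₚ xₚ        ≈⟨ flip-sign 1ₚ xₚ ⟩
      -ₚ (xₚ +ₚ -ₚ 1ₚ)   ≈⟨ ℙ.-‿cong x-1ₚ≈xₚ-1ₚ ⟨
      -ₚ x-1ₚ            ∎
      where
      rev-tt : rev (ρ t t) (f t t) ≈ₚ 1ₚ
      rev-tt = subst (λ r → rev r (f t t) ≈ₚ 1ₚ) (sym (ρ-diag R t))
                     (ℙ.trans (rev-constant (f t t) (λ n → f-diag t (suc n))) (f-diag t))
      flip-sign : ∀ o x → o +ₚ -ₚ x ≈ₚ -ₚ (x +ₚ -ₚ o)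
      flip-sign = solve 2 (λ o x → o :- x := :- (x :- o)) ℙ.refl
    M-interior : Σₚ (λ w → H s w *ₚ M w t) I ≈ₚ x-1ₚ *ₚ T
    M-interior = ℙ.trans (Σₚ-cong I term) (ℙ.sym (Σₚ-*ˡ x-1ₚ (λ w → H s w *ₚ (xₚ *ₚ Q (ρ w t ∸ 1) (f w t))) I))
      where
      term : ∀ {w} → w ∈ I → H s w *ₚ M w t ≈ₚ x-1ₚ *ₚ (H s w *ₚ (xₚ *ₚ Q (ρ w t ∸ 1) (f w t)))
      term {w} w∈I = ℙ.trans (*ₚ-congˡ (H s w) (ℙ.sym (x-1ₚ*xₚ*Q (ρ w t) (f w t) (f-deg w t (proj₂ (in-I w∈I))))))
                             (x*yz≈y*xz (H s w) x-1ₚ _)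
    equation : -ₚ (x-1ₚ *ₚ f s t) ≈ₚ x-1ₚ *ₚ (Qst +ₚ -ₚ f s t) +ₚ (H s t *ₚ -ₚ x-1ₚ +ₚ x-1ₚ *ₚ T)
    equation = begin
      -ₚ (x-1ₚ *ₚ f s t)
        ≈⟨ H⋆M (proj₁ s<t) ⟨
      (H ⋆ M) s t
        ≈⟨ split (λ w → H s w *ₚ M w t) ⟩
      H s s *ₚ M s t +ₚ (H s t *ₚ M t t +ₚ Σₚ (λ w → H s w *ₚ M w t) I)
        ≈⟨ ℙ.+-cong (ℙ.trans (*ₚ-congʳ (M s t) (H-diag s)) (ℙ.trans (*ₚ-identityˡ (M s t)) M-st))
                    (ℙ.+-cong (*ₚ-congˡ (H s t) M-tt) M-interior) ⟩
      x-1ₚ *ₚ (Qst +ₚ -ₚ f s t) +ₚ (H s t *ₚ -ₚ x-1ₚ +ₚ x-1ₚ *ₚ T) ∎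
    solve-for-H : ∀ y g q h r → -ₚ (y *ₚ g) ≈ₚ y *ₚ (q +ₚ -ₚ g) +ₚ (h *ₚ -ₚ y +ₚ y *ₚ r) → y *ₚ h ≈ₚ y *ₚ (q +ₚ r)
    solve-for-H y g q h r eq = begin
      y *ₚ h                                  ≈⟨ rearrange y g q h r ⟩
      y *ₚ (q +ₚ r) +ₚ (-ₚ (y *ₚ g) +ₚ -ₚ E)  ≈⟨ ℙ.+-congˡ {y *ₚ (q +ₚ r)} (ℙ.+-congʳ { -ₚ E} eq) ⟩
      y *ₚ (q +ₚ r) +ₚ (E +ₚ -ₚ E)            ≈⟨ ℙ.+-congˡ {y *ₚ (q +ₚ r)} (ℙ.-‿inverseʳ E) ⟩
      y *ₚ (q +ₚ r) +ₚ 0ₚ                     ≈⟨ ℙ.+-identityʳ _ ⟩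
      y *ₚ (q +ₚ r)                           ∎
      where
      E : Poly
      E = y *ₚ (q +ₚ -ₚ g) +ₚ (h *ₚ -ₚ y +ₚ y *ₚ r)
      rearrange : ∀ y g q h r → y *ₚ h ≈ₚ y *ₚ (q +ₚ r) +ₚ (-ₚ (y *ₚ g) +ₚ -ₚ (y *ₚ (q +ₚ -ₚ g) +ₚ (h *ₚ -ₚ y +ₚ y *ₚ r)))
      rearrange = solve 5 (λ y g q h r → y :* h := y :* (q :+ r) :+ (:- (y :* g) :- (y :* (q :- g) :+ (h :* (:- y) :+ y :* r))))
                          ℙ.refl

  module _ (f≥0 : ∀ s t → s ≤ t → NonNeg (f s t)) where

    H-SymUnimodal : ∀ {s t} → s < t → SymUnimodal (ρ s t ∸ 1) (H s t)
    H-SymUnimodal {s} {t} s<t = bounded (ρ s t) s<t ℕP.≤-refl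
      where
      bounded : ∀ n {s t} → s < t → ρ s t ℕ.≤ n → SymUnimodal (ρ s t ∸ 1) (H s t)
      bounded zero    {s} {t} s<t ρ≤0 = ⊥-elim (ℕP.<⇒≱ (pos s t s<t) ρ≤0)
      bounded (suc n) {s} {t} s<t ρ≤n =
        su-≈ (ℙ.sym H≈) (su-+ (SymUnimodal-Q (ρ s t) (f s t) (f≥0 s t (proj₁ s<t))) (SymUnimodal-Σₚ interior term))
        where
        open Recursion (chow-recursion s<t)
        term : ∀ {w} → w ∈ interior → SymUnimodal (ρ s t ∸ 1) (H s w *ₚ (xₚ *ₚ Q (ρ w t ∸ 1) (f w t)))
        term {w} w∈I = su-reindex degree
          (SymUnimodal-* (bounded n s<w ρsw≤n) (SymUnimodal-xₚ*Q (ρ w t) (f w t) (f≥0 w t (proj₁ w<t))))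
          where
          s<w : s < w
          s<w = proj₁ (∈-interior w∈I)
          w<t : w < t
          w<t = proj₂ (∈-interior w∈I)
          ρ-split : ρ s t ≡ ρ s w ℕ.+ ρ w t
          ρ-split = additive s w t (proj₁ s<w) (proj₁ w<t)
          ρsw≤n : ρ s w ℕ.≤ n
          ρsw≤n = ℕP.≤-pred (ℕP.≤-trans (ℕP.m<m+n (ρ s w) (pos w t w<t)) (subst (ℕ._≤ suc n) ρ-split ρ≤n))
          degree : (ρ s w ∸ 1) ℕ.+ ρ w t ≡ ρ s t ∸ 1
          degree = trans (sym (ℕP.+-∸-comm (ρ w t) (pos s w s<w))) (cong (_∸ 1) (sym ρ-split))

    -- Equality of points is not decidable, but UnimodalAbout is stable under double negation,
    -- so the cases s ≡ t and s < t may be distinguished.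
    H-unimodal : ∀ s t → s ≤ t → NonNeg (H s t) × Unimodal (H s t)
    H-unimodal s t s≤t = UnimodalAbout⇒Unimodal (UnimodalAbout-stable ¬¬unimodal)
      where
      diagonal : s ≡ t → UnimodalAbout (ρ s t ∸ 1) (H s t)
      diagonal refl = subst (λ r → UnimodalAbout (r ∸ 1) (H s s)) (sym (ρ-diag R s))
                            (UnimodalAbout-≈ (ℙ.trans [1]ₓ≈1ₚ (ℙ.sym (H-diag s))) (UnimodalAbout-[]ₓ 0))
      ¬¬unimodal : ¬ ¬ UnimodalAbout (ρ s t ∸ 1) (H s t)
      ¬¬unimodal ¬unimodal =
        ¬unimodal (SymUnimodal⇒UnimodalAbout (H-SymUnimodal (s≤t , ¬unimodal ∘ diagonal)))

-- The opposite poset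

module Opposite {c ℓ : Level} (P : LocallyFinitePoset c ℓ) (R : WeakRank P) where
  open LocallyFinitePoset P
  open WeakRank R

  Pᵒᵖ : LocallyFinitePoset c ℓ
  Pᵒᵖ = record
    { Carrier         = Carrier
    ; _≤_             = flip _≤_
    ; isPartialOrder  = Flip.isPartialOrder isPartialOrder
    ; interval        = flip interval
    ; interval-unique = flip interval-unique
    ; interval-mem    = λ s t w → mk⇔ (swap ∘ Equivalence.to (interval-mem t s w))
                                      (Equivalence.from (interval-mem t s w) ∘ swap) }

  <ᵒᵖ⇒> : ∀ {s t} → LocallyFinitePoset._<_ Pᵒᵖ s t → t < s
  <ᵒᵖ⇒> (t≤s , s≢t) = t≤s , s≢t ∘ sym

  Rᵒᵖ : WeakRank Pᵒᵖ
  Rᵒᵖ = record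
    { ρ        = flip ρ
    ; pos      = λ s t → pos t s ∘ <ᵒᵖ⇒>
    ; additive = λ s w t s≥w w≥t → trans (additive t w s w≥t s≥w) (ℕP.+-comm (ρ t w) (ρ w s)) }

  infix 10 _ᵀ
  _ᵀ : Inc P → Inc Pᵒᵖ
  (a ᵀ) s t = a t s

  ⊛-ᵀ : ∀ a b s t → _⊛_ Pᵒᵖ (b ᵀ) (a ᵀ) s t ≈ₚ _⊛_ P a b t s
  ⊛-ᵀ a b s t = Σₚ-cong (interval t s) (λ {w} _ → *ₚ-comm (b w s) (a t w))

  IsDelta-ᵀ : ∀ a b → IsDelta P (_⊛_ P a b) → IsDelta Pᵒᵖ (_⊛_ Pᵒᵖ (b ᵀ) (a ᵀ))
  IsDelta-ᵀ a b (diag , off) =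
    (λ s → ℙ.trans (⊛-ᵀ a b s s) (diag s)) , (λ s t s>t → ℙ.trans (⊛-ᵀ a b s t) (off t s (<ᵒᵖ⇒> s>t)))

  IsChow-ᵀ : ∀ {κ H} → IsChow P R κ H → IsChow Pᵒᵖ Rᵒᵖ (κ ᵀ) (H ᵀ)
  IsChow-ᵀ {H = H} (κ̄ , (κ̄-diag , x-1ₚ*κ̄) , κ̄⋆-H≈δ , -H⋆κ̄≈δ) =
    κ̄ ᵀ , (κ̄-diag , λ s t s>t → x-1ₚ*κ̄ t s (<ᵒᵖ⇒> s>t)) ,
    IsDelta-ᵀ (λ s t → -ₚ H s t) κ̄ -H⋆κ̄≈δ , IsDelta-ᵀ κ̄ (λ s t → -ₚ H s t) κ̄⋆-H≈δ

  IsLeftKLS⇒IsRightKLSᵀ : ∀ {κ g} → IsLeftKLS P R κ g → IsRightKLS Pᵒᵖ Rᵒᵖ (κ ᵀ) (g ᵀ)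
  IsLeftKLS⇒IsRightKLSᵀ {κ} {g} (g∈Iρ , g-diag , g-deg , g-rev) =
    (λ s t t≤s → g∈Iρ t s t≤s) , g-diag , (λ s t s>t → g-deg t s (<ᵒᵖ⇒> s>t)) ,
    (λ s t t≤s → ℙ.trans (g-rev t s t≤s) (ℙ.sym (⊛-ᵀ g κ s t)))

theorem3p12 : {c ℓ : Level} (P : LocallyFinitePoset c ℓ) (R : WeakRank P)
    (κ f g H : Inc P) →
    IsKernel P R κ → IsRightKLS P R κ f → IsLeftKLS P R κ g → IsChow P R κ H →
    ((∀ s t → LocallyFinitePoset._≤_ P s t → NonNeg (f s t))
      ⊎ (∀ s t → LocallyFinitePoset._≤_ P s t → NonNeg (g s t))) →
    ∀ s t → LocallyFinitePoset._≤_ P s t → NonNeg (H s t) × Unimodal (H s t)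
theorem3p12 P R κ f g H (_ , κ-diag , _) right left chow (inj₁ f≥0) =
  ChowFunction.H-unimodal P R κ-diag right chow f≥0
theorem3p12 P R κ f g H (_ , κ-diag , _) right left chow (inj₂ g≥0) s t s≤t =
  ChowFunction.H-unimodal Pᵒᵖ Rᵒᵖ κ-diag (IsLeftKLS⇒IsRightKLSᵀ left) (IsChow-ᵀ chow) (λ s t t≤s → g≥0 t s t≤s) t s s≤t
  where open Opposite P R
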